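{- Let $d_1,d_2,d_3$ be positive integers and $m_1,m_2\in\{0,1,2\}$ with $3\mid d_1+d_2+d_3+m_1+m_2+2$, and let $F=C(d_1,m_1,d_2,m_2,d_3)$, which has $N=d_1+d_2+d_3+m_1+m_2+3$ vertices. Let $\chi$ be a $\mathbb{Z}_3$-coloring of the edges of $K_N$ with $\alpha_{C_4}(\chi)\ge 1$ such that there is an alternating $4$-cycle $C$ for which the coloring restricted to $K_N-V(C)$ is not monochromatic. Then $K_N$ contains a copy of $F$ whose edge colors sum to $0$ in $\mathbb{Z}_3$.
   Context: $C(d_1,m_1,d_2,m_2,d_3)$ is the tree consisting of three vertices $p_1,p_2,p_3$, where $p_1,p_2$ are joined by a path with $m_1$ internal vertices, $p_2,p_3$ are joined by a path with $m_2$ internal vertices, and each $p_i$ additionally has $d_i$ leaf neighbors. For a $\mathbb{Z}_3$-coloring $\chi$ of a complete graph, a $4$-cycle is alternating if the sums of the colors on its two perfect matchings are distinct, and $\alpha_{C_4}(\chi)$ is the maximum number of pairwise vertex-disjoint alternating $4$-cycles. -}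

module Defs where

open import Data.Nat using (ℕ; zero; suc; _+_; _%_; _≤_; _<_)
open import Data.Fin using (Fin; toℕ)
open import Data.List using (List; []; _∷_; _++_; map; upTo)
open import Data.Nat.ListAction using (sum)
open import Data.Product using (_×_; _,_; proj₁; proj₂; Σ; ∃)
open import Relation.Binary.PropositionalEquality using (_≡_; _≢_)
open import Relation.Nullary using (¬_)

-- A Z_3-colouring of the edges of K_N: a symmetric map on pairs of vertices
-- (values on the diagonal are irrelevant). Colours are Fin 3 = {0,1,2}; sums in
-- Z_3 are computed as natural-number sums of the representatives, reduced mod 3.
Coloring : ℕ → Set
Coloring N = Fin N → Fin N → Fin 3

Symmetric : {N : ℕ} → Coloring N → Set
Symmetric {N} χ = (u v : Fin N) → χ u v ≡ χ v u

col : {N : ℕ} → Coloring N → Fin N → Fin N → ℕ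
col χ u v = toℕ (χ u v)

-- The 4-cycle a-b-c-d-a on four distinct vertices.
record C4 (N : ℕ) : Set where
  constructor c4
  field
    a b c d : Fin N
    ab : a ≢ b
    ac : a ≢ c
    ad : a ≢ d
    bc : b ≢ c
    bd : b ≢ d
    cd : c ≢ d
open C4 public

Alternating : {N : ℕ} → Coloring N → C4 N → Set
Alternating χ C =
  ((col χ (a C) (b C) + col χ (c C) (d C)) % 3) ≢ ((col χ (b C) (c C) + col χ (d C) (a C)) % 3)

-- alpha_{C4}(χ) ≥ 1 : some alternating 4-cycle exists (one vertex-disjoint alternating 4-cycle).
AlphaC4≥1 : {N : ℕ} → Coloring N → Set
AlphaC4≥1 {N} χ = Σ (C4 N) λ C → Alternating χ C

OffCycle : {N : ℕ} → C4 N → Fin N → Set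
OffCycle C v = (v ≢ a C) × (v ≢ b C) × (v ≢ c C) × (v ≢ d C)

NotMonoOff : {N : ℕ} → Coloring N → C4 N → Set
NotMonoOff {N} χ C =
  Σ (Fin N) λ u → Σ (Fin N) λ v → Σ (Fin N) λ x → Σ (Fin N) λ y →
    OffCycle C u × OffCycle C v × OffCycle C x × OffCycle C y ×
    (u ≢ v) × (x ≢ y) × (χ u v ≢ χ x y)

pathEdges : ℕ → ℕ → ℕ → ℕ → List (ℕ × ℕ)
pathEdges p q s zero = (p , q) ∷ []
pathEdges p q s (suc m) = (p , s) ∷ pathEdges s q (suc s) m

starEdges : ℕ → ℕ → ℕ → List (ℕ × ℕ)
starEdges p s d = map (λ i → (p , s + i)) (upTo d)

-- C(d1,m1,d2,m2,d3) on vertex labels 0..N-1 (N = d1+d2+d3+m1+m2+3):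
-- p1 = 0, p2 = 1, p3 = 2; internal vertices of the p1-p2 path are 3..3+m1-1,
-- of the p2-p3 path 3+m1..3+m1+m2-1; then the d1 leaves of p1, d2 leaves of p2, d3 leaves of p3.
C-edges : ℕ → ℕ → ℕ → ℕ → ℕ → List (ℕ × ℕ)
C-edges d1 m1 d2 m2 d3 =
  pathEdges 0 1 3 m1 ++
  pathEdges 1 2 (3 + m1) m2 ++
  starEdges 0 (3 + m1 + m2) d1 ++
  starEdges 1 (3 + m1 + m2 + d1) d2 ++
  starEdges 2 (3 + m1 + m2 + d1 + d2) d3

C-order : ℕ → ℕ → ℕ → ℕ → ℕ → ℕ
C-order d1 m1 d2 m2 d3 = d1 + d2 + d3 + m1 + m2 + 3

-- A copy of a graph with vertex labels 0..n-1 in K_N: an injective labelling f.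
InjectiveOn : {N : ℕ} → ℕ → (ℕ → Fin N) → Set
InjectiveOn n f = (i j : ℕ) → i < n → j < n → f i ≡ f j → i ≡ j

edgeColorSum : {N : ℕ} → Coloring N → (ℕ → Fin N) → List (ℕ × ℕ) → ℕ
edgeColorSum χ f es = sum (map (λ e → col χ (f (proj₁ e)) (f (proj₂ e))) es) % 3

HasZeroSumCopy : (d1 m1 d2 m2 d3 : ℕ) {N : ℕ} → Coloring N → Set
HasZeroSumCopy d1 m1 d2 m2 d3 {N} χ =
  Σ (ℕ → Fin N) λ f →
    InjectiveOn (C-order d1 m1 d2 m2 d3) f × (edgeColorSum χ f (C-edges d1 m1 d2 m2 d3) ≡ 0)

{-# OPTIONS --safe #-}
-- Suppose no copy of F = C(d1,m1,d2,m2,d3) has colour sum 0, and read an injective labelling h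
-- of F by vertices of K_N as a copy of weight Σ χ(h i, h j) ∈ ℤ₃ over the edges ij of F. Place
-- the alternating cycle a b c d on two centres of F and a leaf of each, with a and c on the
-- centres: swapping b and d changes the weight by δ = (χ a d − χ a b) + (χ c b − χ c d), which is
-- nonzero because C is alternating. If swapping two vertices z, w off C changed the weight by ε,
-- the weights t, t + δ, t + ε, t + ε + δ of h and of its three swapped versions would all be
-- nonzero, and in ℤ₃ this forces ε = 0. Placing z, w and a third vertex Y according to the shape
-- of F, the vanishing of such ε shows χ Y z = χ Y w for all distinct Y, z, w off C, so K_N − V(C)
-- is monochromatic. When both paths of F are trivial, some swaps move a centre and change the
-- weight by d3, d1 or d2 + 1 equal terms; the divisibility hypothesis makes one of these prime to 3.
module Submission where

open import Defs
open import Algebra.Bundles using (CommutativeRing)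
open import Data.Bool using (if_then_else_)
open import Data.Empty using (⊥-elim)
open import Data.Fin using (Fin; toℕ; fromℕ<)
open import Data.Fin.Patterns using (0F; 1F; 2F)
open import Data.Fin.Permutation.Components using (transpose; transpose-inverse)
open import Data.Fin.Properties using (_≟_; all?; toℕ-fromℕ<; toℕ<n)
open import Data.List using (List; []; _∷_; _++_; map; applyUpTo)
open import Data.List.Relation.Unary.All using (All; []; _∷_)
import Data.List.Relation.Unary.All as All
open import Data.List.Relation.Unary.All.Properties using (++⁺)
open import Data.List.Relation.Unary.AllPairs using ([]; _∷_)
open import Data.List.Relation.Unary.Unique.Propositional using (Unique)
open import Data.Maybe using (just; nothing)
open import Data.Nat using (ℕ; zero; suc; _+_; _∸_; _<_; _≤_; s≤s; z<s; s<s; sz<ss; _<?_; NonZero)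
  renaming (_≟_ to _≟ℕ_)
open import Data.Nat.DivMod using (_mod_; _%_; %-distribˡ-+; m%n%n≡m%n)
open import Data.Nat.Divisibility using (_∣_; _∣?_; _∣0; ∣-refl; ∣m∣n⇒∣m+n; ∣m+n∣m⇒∣n)
open import Data.Nat.ListAction using (sum)
open import Data.Nat.Properties
  using (suc-injective; +-identityʳ; +-suc; +-assoc; ≤-refl; ≤-trans; ≤-reflexive; <-≤-trans; <⇒≤; <⇒≢;
         m<n⇒m<1+n; m≤m+n; +-monoʳ-<; m+n≮m; m+n∸m≡n; m∸n≤m; m∸[m∸n]≡n; m<n⇒0<n∸m; n≤1+n)
import Data.Nat.Tactic.RingSolver as ℕ-Solver
open import Data.Product using (Σ; _×_; _,_; proj₁; proj₂)
open import Data.Product.Properties using (≡-dec)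
open import Data.Sum using (_⊎_; inj₁; inj₂; [_,_]′)
import Data.Sum.Effectful.Left as Sumₗ
open import Data.Unit using (⊤; tt)
open import Effect.Monad using (RawMonad)
open import Function using (_∘_; id)
open import Level using (0ℓ)
open import Relation.Binary.Definitions using (DecidableEquality)
open import Relation.Binary.PropositionalEquality
  using (_≡_; _≢_; refl; sym; trans; cong; cong₂; subst; isEquivalence; module ≡-Reasoning)
open import Relation.Nullary using (¬_; yes; no; does)
open import Relation.Nullary.Decidable
  using (True; False; from-yes; from-no; toWitness; toWitnessFalse; fromWitnessFalse; _→-dec_; ¬?;
         dec-true; dec-false; map′)
import Tactic.RingSolver.Core.AlmostCommutativeRing as ACR
open import Tactic.RingSolver using (solve-∀)

open ≡-Reasoning

-- The operations are defined
-- by pattern matching, so they compute on closed values (as the ring solver needs) and are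
-- stuck on variables; every law below is a finite check, decided by enumerating Fin 3.
ℤ₃ : Set
ℤ₃ = Fin 3

infixl 6 _⊕_ _⊖_
infixl 7 _⊗_
infix 8 ⊝_

rotate : ℤ₃ → ℤ₃
rotate 0F = 1F
rotate 1F = 2F
rotate 2F = 0F

_⊕_ : ℤ₃ → ℤ₃ → ℤ₃
0F ⊕ y = y
1F ⊕ y = rotate y
2F ⊕ y = rotate (rotate y)

⊝_ : ℤ₃ → ℤ₃
⊝ 0F = 0F
⊝ 1F = 2F
⊝ 2F = 1F

_⊗_ : ℤ₃ → ℤ₃ → ℤ₃
0F ⊗ y = 0F
1F ⊗ y = y
2F ⊗ y = ⊝ y

_⊖_ : ℤ₃ → ℤ₃ → ℤ₃
x ⊖ y = x ⊕ ⊝ y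

toℕ-⊕ : ∀ x y → toℕ (x ⊕ y) ≡ (toℕ x + toℕ y) % 3
toℕ-⊕ = from-yes (all? λ x → all? λ y → toℕ (x ⊕ y) ≟ℕ (toℕ x + toℕ y) % 3)

⊕-assoc : ∀ x y z → (x ⊕ y) ⊕ z ≡ x ⊕ (y ⊕ z)
⊕-assoc = from-yes (all? λ x → all? λ y → all? λ z → (x ⊕ y) ⊕ z ≟ x ⊕ (y ⊕ z))

⊕-comm : ∀ x y → x ⊕ y ≡ y ⊕ x
⊕-comm = from-yes (all? λ x → all? λ y → x ⊕ y ≟ y ⊕ x)

⊕-identityˡ : ∀ x → 0F ⊕ x ≡ x
⊕-identityˡ = from-yes (all? λ x → 0F ⊕ x ≟ x)

⊕-identityʳ : ∀ x → x ⊕ 0F ≡ x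
⊕-identityʳ = from-yes (all? λ x → x ⊕ 0F ≟ x)

⊝-inverseˡ : ∀ x → ⊝ x ⊕ x ≡ 0F
⊝-inverseˡ = from-yes (all? λ x → ⊝ x ⊕ x ≟ 0F)

x⊖x≡0 : ∀ x → x ⊖ x ≡ 0F
x⊖x≡0 = from-yes (all? λ x → x ⊖ x ≟ 0F)

⊗-assoc : ∀ x y z → (x ⊗ y) ⊗ z ≡ x ⊗ (y ⊗ z)
⊗-assoc = from-yes (all? λ x → all? λ y → all? λ z → (x ⊗ y) ⊗ z ≟ x ⊗ (y ⊗ z))

⊗-comm : ∀ x y → x ⊗ y ≡ y ⊗ x
⊗-comm = from-yes (all? λ x → all? λ y → x ⊗ y ≟ y ⊗ x)

⊗-identityˡ : ∀ x → 1F ⊗ x ≡ x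
⊗-identityˡ = from-yes (all? λ x → 1F ⊗ x ≟ x)

⊗-identityʳ : ∀ x → x ⊗ 1F ≡ x
⊗-identityʳ = from-yes (all? λ x → x ⊗ 1F ≟ x)

⊗-distribˡ-⊕ : ∀ x y z → x ⊗ (y ⊕ z) ≡ x ⊗ y ⊕ x ⊗ z
⊗-distribˡ-⊕ = from-yes (all? λ x → all? λ y → all? λ z → x ⊗ (y ⊕ z) ≟ x ⊗ y ⊕ x ⊗ z)

⊗-distribʳ-⊕ : ∀ x y z → (y ⊕ z) ⊗ x ≡ y ⊗ x ⊕ z ⊗ x
⊗-distribʳ-⊕ = from-yes (all? λ x → all? λ y → all? λ z → (y ⊕ z) ⊗ x ≟ y ⊗ x ⊕ z ⊗ x)

x⊖y≡0⇒x≡y : ∀ x y → x ⊖ y ≡ 0F → x ≡ y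
x⊖y≡0⇒x≡y = from-yes (all? λ x → all? λ y → (x ⊖ y ≟ 0F) →-dec (x ≟ y))

x⊕[y⊖z]≡0⇒x≡z⊖y : ∀ x y z → x ⊕ (y ⊖ z) ≡ 0F → x ≡ z ⊖ y
x⊕[y⊖z]≡0⇒x≡z⊖y = from-yes (all? λ x → all? λ y → all? λ z →
  (x ⊕ (y ⊖ z) ≟ 0F) →-dec (x ≟ z ⊖ y))

[x⊖y]⊕[u⊖v]≡0⇒y⊕v≡u⊕x : ∀ x y u v → (x ⊖ y) ⊕ (u ⊖ v) ≡ 0F → y ⊕ v ≡ u ⊕ x
[x⊖y]⊕[u⊖v]≡0⇒y⊕v≡u⊕x = from-yes (all? λ x → all? λ y → all? λ u → all? λ v →
  ((x ⊖ y) ⊕ (u ⊖ v) ≟ 0F) →-dec (y ⊕ v ≟ u ⊕ x))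

x⊕x≡0⇒x≡0 : ∀ x → x ⊕ x ≡ 0F → x ≡ 0F
x⊕x≡0⇒x≡0 = from-yes (all? λ x → (x ⊕ x ≟ 0F) →-dec (x ≟ 0F))

x⊕[x⊕[x⊕y]]≡y : ∀ x y → x ⊕ (x ⊕ (x ⊕ y)) ≡ y
x⊕[x⊕[x⊕y]]≡y = from-yes (all? λ x → all? λ y → x ⊕ (x ⊕ (x ⊕ y)) ≟ y)

-- If t, t ⊕ δ, t ⊕ ε and t ⊕ ε ⊕ δ all avoid 0 and δ ≢ 0, then t and t ⊕ δ are the two
-- nonzero residues, so t ⊕ ε can only be t.
four-nonzero⇒≡0 : ∀ t δ ε → δ ≢ 0F →
  t ≢ 0F → t ⊕ δ ≢ 0F → t ⊕ ε ≢ 0F → t ⊕ ε ⊕ δ ≢ 0F → ε ≡ 0F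
four-nonzero⇒≡0 = from-yes (all? λ t → all? λ δ → all? λ ε →
  ¬? (δ ≟ 0F) →-dec ¬? (t ≟ 0F) →-dec ¬? (t ⊕ δ ≟ 0F) →-dec ¬? (t ⊕ ε ≟ 0F) →-dec
  ¬? (t ⊕ ε ⊕ δ ≟ 0F) →-dec (ε ≟ 0F))

ℤ₃-commutativeRing : CommutativeRing 0ℓ 0ℓ
ℤ₃-commutativeRing = record
  { Carrier = ℤ₃ ; _≈_ = _≡_ ; _+_ = _⊕_ ; _*_ = _⊗_ ; -_ = ⊝_ ; 0# = 0F ; 1# = 1F
  ; isCommutativeRing = record
    { isRing = record
      { +-isAbelianGroup = record
        { isGroup = record
          { isMonoid = record
            { isSemigroup = record
              { isMagma = record { isEquivalence = isEquivalence ; ∙-cong = cong₂ _⊕_ }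
              ; assoc = ⊕-assoc }
            ; identity = ⊕-identityˡ , ⊕-identityʳ }
          ; inverse = ⊝-inverseˡ , x⊖x≡0
          ; ⁻¹-cong = cong ⊝_ }
        ; comm = ⊕-comm }
      ; *-cong = cong₂ _⊗_
      ; *-assoc = ⊗-assoc
      ; *-identity = ⊗-identityˡ , ⊗-identityʳ
      ; distrib = ⊗-distribˡ-⊕ , ⊗-distribʳ-⊕ }
    ; *-comm = ⊗-comm } }

ℤ₃-ring : ACR.AlmostCommutativeRing 0ℓ 0ℓ
ℤ₃-ring = ACR.fromCommutativeRing ℤ₃-commutativeRing λ { 0F → just refl ; _ → nothing }

infixr 7 _·_
_·_ : ℕ → ℤ₃ → ℤ₃
zero · x = 0F
suc n · x = x ⊕ n · x

·-cancel : ∀ n x → ¬ 3 ∣ n → n · x ≡ 0F → x ≡ 0F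
·-cancel 0 x 3∤n _ = ⊥-elim (3∤n (3 ∣0))
·-cancel 1 x _ 1·x≡0 = trans (sym (⊕-identityʳ x)) 1·x≡0
·-cancel 2 x _ 2·x≡0 = x⊕x≡0⇒x≡0 x (trans (cong (x ⊕_) (sym (⊕-identityʳ x))) 2·x≡0)
·-cancel (suc (suc (suc n))) x 3∤n 3+n·x≡0 =
  ·-cancel n x (3∤n ∘ ∣m∣n⇒∣m+n ∣-refl) (trans (sym (x⊕[x⊕[x⊕y]]≡y x (n · x))) 3+n·x≡0)

∑ : ℕ → (ℕ → ℤ₃) → ℤ₃
∑ zero f = 0F
∑ (suc n) f = f 0 ⊕ ∑ n (f ∘ suc)

∑-zero : ∀ n {f} → (∀ i → i < n → f i ≡ 0F) → ∑ n f ≡ 0F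
∑-zero zero _ = refl
∑-zero (suc n) f≡0 =
  trans (cong₂ _⊕_ (f≡0 0 z<s) (∑-zero n λ i i<n → f≡0 (suc i) (s<s i<n))) (⊕-identityˡ 0F)

∑-single : ∀ n {f k} → k < n → (∀ i → i < n → i ≢ k → f i ≡ 0F) → ∑ n f ≡ f k
∑-single (suc n) {f} {zero} _ f≡0 =
  trans (cong (f 0 ⊕_) (∑-zero n λ i i<n → f≡0 (suc i) (s<s i<n) λ ())) (⊕-identityʳ (f 0))
∑-single (suc n) {f} {suc k} (s<s k<n) f≡0 =
  trans (cong₂ _⊕_ (f≡0 0 z<s λ ())
                   (∑-single n k<n λ i i<n i≢k → f≡0 (suc i) (s<s i<n) (i≢k ∘ suc-injective)))
        (⊕-identityˡ (f (suc k)))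

∑-const : ∀ n {f κ} → (∀ i → i < n → f i ≡ κ) → ∑ n f ≡ n · κ
∑-const zero _ = refl
∑-const (suc n) f≡κ = cong₂ _⊕_ (f≡κ 0 z<s) (∑-const n λ i i<n → f≡κ (suc i) (s<s i<n))

∑-all-but-one : ∀ n {f k κ} → k < n → f k ≡ 0F → (∀ i → i < n → i ≢ k → f i ≡ κ) →
                κ ⊕ ∑ n f ≡ n · κ
∑-all-but-one (suc n) {f} {zero} {κ} _ f0≡0 f≡κ =
  cong (κ ⊕_) (trans (cong₂ _⊕_ f0≡0 (∑-const n λ i i<n → f≡κ (suc i) (s<s i<n) λ ()))
                     (⊕-identityˡ (n · κ)))
∑-all-but-one (suc n) {f} {suc k} {κ} (s<s k<n) fk≡0 f≡κ =
  cong (κ ⊕_) (trans (cong (_⊕ ∑ n (f ∘ suc)) (f≡κ 0 z<s λ ()))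
                     (∑-all-but-one n k<n fk≡0 λ i i<n i≢k →
                        f≡κ (suc i) (s<s i<n) (i≢k ∘ suc-injective)))

sequence< : ∀ {Z : Set} {P : ℕ → Set} n → (∀ i → i < n → Z ⊎ P i) → Z ⊎ (∀ i → i < n → P i)
sequence< zero _ = inj₂ λ _ ()
sequence< (suc n) f with f 0 z<s | sequence< n (λ i i<n → f (suc i) (s<s i<n))
... | inj₁ z  | _      = inj₁ z
... | inj₂ _  | inj₁ z = inj₁ z
... | inj₂ p0 | inj₂ p = inj₂ λ { zero _ → p0 ; (suc i) (s<s i<n) → p i i<n }

module _ {n : ℕ} (i j : Fin n) where

  transpose-matchˡ : transpose i j i ≡ j
  transpose-matchˡ rewrite dec-true (i ≟ i) refl = refl

  transpose-matchʳ : transpose i j j ≡ i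
  transpose-matchʳ with i ≟ j
  ... | yes refl = transpose-matchˡ
  ... | no i≢j rewrite dec-false (j ≟ i) (i≢j ∘ sym) | dec-true (j ≟ j) refl = refl

  transpose-other : ∀ {k} → k ≢ i → k ≢ j → transpose i j k ≡ k
  transpose-other {k} k≢i k≢j rewrite dec-false (k ≟ i) k≢i | dec-false (k ≟ j) k≢j = refl

  transpose-injective : ∀ {k l} → transpose i j k ≡ transpose i j l → k ≡ l
  transpose-injective {k} {l} e =
    trans (sym (transpose-inverse j i)) (trans (cong (transpose j i) e) (transpose-inverse j i))

[m+n%d]%d≡[m+n]%d : ∀ m n d .{{_ : NonZero d}} → (m + n % d) % d ≡ (m + n) % d
[m+n%d]%d≡[m+n]%d m n d = begin
  (m + n % d) % d          ≡⟨ %-distribˡ-+ m (n % d) d ⟩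
  (m % d + n % d % d) % d  ≡⟨ cong (λ k → (m % d + k) % d) (m%n%n≡m%n n d) ⟩
  (m % d + n % d) % d      ≡⟨ %-distribˡ-+ m n d ⟨
  (m + n) % d              ∎

edgeSum : (ℕ → ℕ → ℤ₃) → List (ℕ × ℕ) → ℤ₃
edgeSum c [] = 0F
edgeSum c ((i , j) ∷ es) = c i j ⊕ edgeSum c es

edgeSum-++ : ∀ c es fs → edgeSum c (es ++ fs) ≡ edgeSum c es ⊕ edgeSum c fs
edgeSum-++ c [] fs = sym (⊕-identityˡ (edgeSum c fs))
edgeSum-++ c ((i , j) ∷ es) fs =
  trans (cong (c i j ⊕_) (edgeSum-++ c es fs)) (sym (⊕-assoc (c i j) (edgeSum c es) (edgeSum c fs)))

edgeSum-star : ∀ c p s d → edgeSum c (starEdges p s d) ≡ ∑ d (λ i → c p (s + i))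
edgeSum-star c p s = go id
  where
  go : ∀ g d → edgeSum c (map (λ i → (p , s + i)) (applyUpTo g d)) ≡ ∑ d (λ i → c p (s + g i))
  go g zero = refl
  go g (suc d) = cong (c p (s + g 0) ⊕_) (go (g ∘ suc) d)

pathEdges-snoc : ∀ p q s m → pathEdges p q s (suc m) ≡ pathEdges p (s + m) s m ++ (s + m , q) ∷ []
pathEdges-snoc p q s zero rewrite +-identityʳ s = refl
pathEdges-snoc p q s (suc m) rewrite +-suc s m = cong ((p , s) ∷_) (pathEdges-snoc s q (suc s) m)

pathSecond : ℕ → ℕ → ℕ → ℕ
pathSecond q s zero = q
pathSecond q s (suc _) = s

pathPenultimate : ℕ → ℕ → ℕ → ℕ
pathPenultimate p s zero = p
pathPenultimate p s (suc m) = s + m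

module Weights {N : ℕ} (χ : Coloring N) (χ-sym : Symmetric χ) where

  Labelling : Set
  Labelling = ℕ → Fin N

  weight : Labelling → List (ℕ × ℕ) → ℤ₃
  weight f = edgeSum (λ i j → χ (f i) (f j))

  edgeColorSum≡weight : ∀ f es → edgeColorSum χ f es ≡ toℕ (weight f es)
  edgeColorSum≡weight f [] = refl
  edgeColorSum≡weight f ((i , j) ∷ es) = begin
    (x + sum (map colour es)) % 3      ≡⟨ [m+n%d]%d≡[m+n]%d x (sum (map colour es)) 3 ⟨
    (x + sum (map colour es) % 3) % 3  ≡⟨ cong (λ k → (x + k) % 3) (edgeColorSum≡weight f es) ⟩
    (x + toℕ (weight f es)) % 3        ≡⟨ toℕ-⊕ (χ (f i) (f j)) (weight f es) ⟨
    toℕ (weight f ((i , j) ∷ es))      ∎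
    where
    x : ℕ
    x = col χ (f i) (f j)
    colour : ℕ × ℕ → ℕ
    colour (u , v) = col χ (f u) (f v)

  Δ : Fin N → Fin N → Fin N → Fin N → ℤ₃
  Δ z w u v = χ (transpose z w u) (transpose z w v) ⊖ χ u v

  swapDelta : Fin N → Fin N → Labelling → List (ℕ × ℕ) → ℤ₃
  swapDelta z w f = edgeSum (λ i j → Δ z w (f i) (f j))

  weight-transpose : ∀ z w f es → weight (transpose z w ∘ f) es ≡ weight f es ⊕ swapDelta z w f es
  weight-transpose z w f [] = sym (⊕-identityˡ 0F)
  weight-transpose z w f ((i , j) ∷ es) =
    trans (cong (χ (transpose z w (f i)) (transpose z w (f j)) ⊕_) (weight-transpose z w f es))
          (shuffle (χ (transpose z w (f i)) (transpose z w (f j))) (χ (f i) (f j)) (weight f es) (swapDelta z w f es))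
    where
    shuffle : ∀ x′ x W D → x′ ⊕ (W ⊕ D) ≡ (x ⊕ W) ⊕ ((x′ ⊖ x) ⊕ D)
    shuffle = solve-∀ ℤ₃-ring

  Avoids : Fin N → Fin N → Fin N → Set
  Avoids z w v = v ≢ z × v ≢ w

  module _ {z w : Fin N} where

    Δ-untouched : ∀ {u v} → Avoids z w u → Avoids z w v → Δ z w u v ≡ 0F
    Δ-untouched {u} {v} (u≢z , u≢w) (v≢z , v≢w) =
      trans (cong₂ (λ x y → χ x y ⊖ χ u v) (transpose-other z w u≢z u≢w) (transpose-other z w v≢z v≢w))
            (x⊖x≡0 (χ u v))

    Δ-zv : ∀ {v} → Avoids z w v → Δ z w z v ≡ χ v w ⊖ χ v z
    Δ-zv {v} (v≢z , v≢w) =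
      cong₂ _⊖_ (trans (cong₂ χ (transpose-matchˡ z w) (transpose-other z w v≢z v≢w)) (χ-sym w v))
                (χ-sym z v)

    Δ-vz : ∀ {v} → Avoids z w v → Δ z w v z ≡ χ v w ⊖ χ v z
    Δ-vz {v} (v≢z , v≢w) = cong (_⊖ χ v z) (cong₂ χ (transpose-other z w v≢z v≢w) (transpose-matchˡ z w))

    Δ-vw : ∀ {v} → Avoids z w v → Δ z w v w ≡ χ v z ⊖ χ v w
    Δ-vw {v} (v≢z , v≢w) = cong (_⊖ χ v w) (cong₂ χ (transpose-other z w v≢z v≢w) (transpose-matchʳ z w))

    Δ-zw : Δ z w z w ≡ 0F
    Δ-zw = trans (cong (_⊖ χ z w) (trans (cong₂ χ (transpose-matchˡ z w) (transpose-matchʳ z w)) (χ-sym w z)))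
                 (x⊖x≡0 (χ z w))

    module _ (f : Labelling) where

      AvoidsRange : ℕ → ℕ → Set
      AvoidsRange s m = ∀ i → i < m → Avoids z w (f (s + i))

      AvoidsRange-head : ∀ {s m} → AvoidsRange s (suc m) → Avoids z w (f s)
      AvoidsRange-head {s} fs = subst (Avoids z w ∘ f) (+-identityʳ s) (fs 0 z<s)

      AvoidsRange-tail : ∀ {s m} → AvoidsRange s (suc m) → AvoidsRange (suc s) m
      AvoidsRange-tail {s} fs i i<m = subst (Avoids z w ∘ f) (+-suc s i) (fs (suc i) (s<s i<m))

      swapDelta-path-untouched : ∀ p q s m → Avoids z w (f p) → Avoids z w (f q) →
        AvoidsRange s m → swapDelta z w f (pathEdges p q s m) ≡ 0F
      swapDelta-path-untouched p q s zero fp fq _ = trans (cong (_⊕ 0F) (Δ-untouched fp fq)) (⊕-identityˡ 0F)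
      swapDelta-path-untouched p q s (suc m) fp fq fs =
        trans (cong₂ _⊕_ (Δ-untouched fp (AvoidsRange-head fs))
                         (swapDelta-path-untouched s q (suc s) m (AvoidsRange-head fs) fq (AvoidsRange-tail fs)))
              (⊕-identityˡ 0F)

      swapDelta-path-start : ∀ p q s m → Avoids z w (f q) → AvoidsRange s m →
        swapDelta z w f (pathEdges p q s m) ≡ Δ z w (f p) (f (pathSecond q s m))
      swapDelta-path-start p q s zero _ _ = ⊕-identityʳ (Δ z w (f p) (f q))
      swapDelta-path-start p q s (suc m) fq fs =
        trans (cong (Δ z w (f p) (f s) ⊕_)
                    (swapDelta-path-untouched s q (suc s) m (AvoidsRange-head fs) fq (AvoidsRange-tail fs)))
              (⊕-identityʳ (Δ z w (f p) (f s)))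

      swapDelta-path-end : ∀ p q s m → Avoids z w (f p) → AvoidsRange s m →
        swapDelta z w f (pathEdges p q s m) ≡ Δ z w (f (pathPenultimate p s m)) (f q)
      swapDelta-path-end p q s zero _ _ = ⊕-identityʳ (Δ z w (f p) (f q))
      swapDelta-path-end p q s (suc m) fp fs = begin
        swapDelta z w f (pathEdges p q s (suc m))
          ≡⟨ cong (swapDelta z w f) (pathEdges-snoc p q s m) ⟩
        swapDelta z w f (pathEdges p (s + m) s m ++ (s + m , q) ∷ [])
          ≡⟨ edgeSum-++ _ (pathEdges p (s + m) s m) _ ⟩
        swapDelta z w f (pathEdges p (s + m) s m) ⊕ (Δ z w (f (s + m)) (f q) ⊕ 0F)
          ≡⟨ cong₂ _⊕_ (swapDelta-path-untouched p (s + m) s m fp (fs m ≤-refl) λ i i<m →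
                          fs i (m<n⇒m<1+n i<m))
                       (⊕-identityʳ (Δ z w (f (s + m)) (f q))) ⟩
        0F ⊕ Δ z w (f (s + m)) (f q)
          ≡⟨ ⊕-identityˡ (Δ z w (f (s + m)) (f q)) ⟩
        Δ z w (f (s + m)) (f q) ∎

  defect : C4 N → ℤ₃
  defect C = (χ (a C) (d C) ⊖ χ (a C) (b C)) ⊕ (χ (c C) (b C) ⊖ χ (c C) (d C))

  alternating⇒defect≢0 : ∀ C → Alternating χ C → defect C ≢ 0F
  alternating⇒defect≢0 (c4 a b c d _ _ _ _ _ _) alt defect≡0 = alt (begin
    (col χ a b + col χ c d) % 3  ≡⟨ toℕ-⊕ (χ a b) (χ c d) ⟨
    toℕ (χ a b ⊕ χ c d)          ≡⟨ cong toℕ matchings ⟩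
    toℕ (χ b c ⊕ χ d a)          ≡⟨ toℕ-⊕ (χ b c) (χ d a) ⟩
    (col χ b c + col χ d a) % 3  ∎)
    where
    matchings : χ a b ⊕ χ c d ≡ χ b c ⊕ χ d a
    matchings = trans ([x⊖y]⊕[u⊖v]≡0⇒y⊕v≡u⊕x (χ a d) (χ a b) (χ c b) (χ c d) defect≡0)
                      (cong₂ _⊕_ (χ-sym c b) (χ-sym a d))

m∸[1+i]<m : ∀ {i m} → i < m → m ∸ suc i < m
m∸[1+i]<m {i} {suc m} _ = s≤s (m∸n≤m m i)

m∸[1+[m∸[1+i]]]≡i : ∀ {i m} → i < m → m ∸ suc (m ∸ suc i) ≡ i
m∸[1+[m∸[1+i]]]≡i {i} {suc m} (s≤s i≤m) = m∸[m∸n]≡n i≤m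

data Label : Set where
  centre : Fin 3 → Label
  mid₁ mid₂ : ℕ → Label
  leaf : Fin 3 → ℕ → Label

pattern p₁ = centre 0F
pattern p₂ = centre 1F
pattern p₃ = centre 2F
pattern leaf₁ i = leaf 0F i
pattern leaf₂ i = leaf 1F i
pattern leaf₃ i = leaf 2F i

leaf-apart : ∀ {t i k} → i ≢ k → leaf t i ≢ leaf t k
leaf-apart i≢k refl = i≢k refl

mid₂-apart : ∀ {i k} → i ≢ k → mid₂ i ≢ mid₂ k
mid₂-apart i≢k refl = i≢k refl

code : Label → ℕ × ℕ
code (centre t) = 0 , toℕ t
code (mid₁ i) = 1 , i
code (mid₂ i) = 2 , i
code (leaf t i) = 3 + toℕ t , i

uncode : ℕ × ℕ → Label
uncode (0 , k) = centre (k mod 3)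
uncode (1 , i) = mid₁ i
uncode (2 , i) = mid₂ i
uncode (suc (suc (suc k)) , i) = leaf (k mod 3) i

uncode-code : ∀ l → uncode (code l) ≡ l
uncode-code (centre 0F) = refl
uncode-code (centre 1F) = refl
uncode-code (centre 2F) = refl
uncode-code (mid₁ _) = refl
uncode-code (mid₂ _) = refl
uncode-code (leaf 0F _) = refl
uncode-code (leaf 1F _) = refl
uncode-code (leaf 2F _) = refl

_≟ₗ_ : DecidableEquality Label
l ≟ₗ l′ = map′ (λ e → trans (sym (uncode-code l)) (trans (cong uncode e) (uncode-code l′))) (cong code)
               (≡-dec _≟ℕ_ _≟ℕ_ (code l) (code l′))

leaf-other : ∀ {t i k} → i ≢ k → False (leaf t i ≟ₗ leaf t k)
leaf-other = fromWitnessFalse ∘ leaf-apart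

order-rearranged : ∀ d1 m1 d2 m2 d3 → 3 + m1 + m2 + d1 + d2 + d3 ≡ d1 + d2 + d3 + m1 + m2 + 3
order-rearranged = ℕ-Solver.solve-∀

module Layout (d1 m1 d2 m2 d3 : ℕ) where

  order : ℕ
  order = C-order d1 m1 d2 m2 d3

  start : Fin 3 → ℕ
  start 0F = 3 + m1 + m2
  start 1F = 3 + m1 + m2 + d1
  start 2F = 3 + m1 + m2 + d1 + d2

  size : Fin 3 → ℕ
  size 0F = d1
  size 1F = d2
  size 2F = d3

  -- The internal vertices of the p₁–p₂ path are counted from p₁ and those of the p₂–p₃ path
  -- from p₃, so that the vertices next to p₃ are mid₂ 0, mid₂ 1 whatever m2 is.
  val : Label → ℕ
  val (centre t) = toℕ t
  val (mid₁ i) = 3 + i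
  val (mid₂ i) = 3 + m1 + (m2 ∸ suc i)
  val (leaf t i) = start t + i

  Valid : Label → Set
  Valid (centre _) = ⊤
  Valid (mid₁ i) = i < m1
  Valid (mid₂ i) = i < m2
  Valid (leaf t i) = i < size t

  private
    below : ℕ → (ℕ → Label) → (ℕ → Label) → ℕ → Label
    below o f g n = if does (n <? o) then f n else g (n ∸ o)

    below-< : ∀ o f g {n} → n < o → below o f g n ≡ f n
    below-< o f g {n} n<o rewrite dec-true (n <? o) n<o = refl

    below-+ : ∀ o f g r → below o f g (o + r) ≡ g r
    below-+ o f g r rewrite dec-false (o + r <? o) (m+n≮m o r) | m+n∸m≡n o r = refl

    centreAt : ℕ → Label
    centreAt k = centre (k mod 3)

    mid₂At : ℕ → Label
    mid₂At j = mid₂ (m2 ∸ suc j)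

    decode₄ decode₃ decode₂ decode₁ : ℕ → Label
    decode₄ = below d2 leaf₂ leaf₃
    decode₃ = below d1 leaf₁ decode₄
    decode₂ = below m2 mid₂At decode₃
    decode₁ = below m1 mid₁ decode₂

  decode : ℕ → Label
  decode = below 3 centreAt decode₁

  decode-val : ∀ l → Valid l → decode (val l) ≡ l
  decode-val (centre 0F) _ = refl
  decode-val (centre 1F) _ = refl
  decode-val (centre 2F) _ = refl
  decode-val (mid₁ i) i<m1 = begin
    decode (3 + i)  ≡⟨ below-+ 3 centreAt decode₁ i ⟩
    decode₁ i       ≡⟨ below-< m1 mid₁ decode₂ i<m1 ⟩
    mid₁ i          ∎
  decode-val (mid₂ i) i<m2 = begin
    decode (3 + (m1 + j))  ≡⟨ below-+ 3 centreAt decode₁ (m1 + j) ⟩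
    decode₁ (m1 + j)       ≡⟨ below-+ m1 mid₁ decode₂ j ⟩
    decode₂ j              ≡⟨ below-< m2 mid₂At decode₃ (m∸[1+i]<m i<m2) ⟩
    mid₂ (m2 ∸ suc j)      ≡⟨ cong mid₂ (m∸[1+[m∸[1+i]]]≡i i<m2) ⟩
    mid₂ i                 ∎
    where
    j : ℕ
    j = m2 ∸ suc i
  decode-val (leaf₁ i) i<d1 = begin
    decode (3 + (m1 + m2 + i))    ≡⟨ cong (decode ∘ (3 +_)) (+-assoc m1 m2 i) ⟩
    decode (3 + (m1 + (m2 + i)))  ≡⟨ below-+ 3 centreAt decode₁ (m1 + (m2 + i)) ⟩
    decode₁ (m1 + (m2 + i))       ≡⟨ below-+ m1 mid₁ decode₂ (m2 + i) ⟩
    decode₂ (m2 + i)              ≡⟨ below-+ m2 mid₂At decode₃ i ⟩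
    decode₃ i                     ≡⟨ below-< d1 leaf₁ decode₄ i<d1 ⟩
    leaf₁ i                       ∎
  decode-val (leaf₂ i) i<d2 = begin
    decode (3 + (m1 + m2 + d1 + i))      ≡⟨ cong (decode ∘ (3 +_)) reassociate ⟩
    decode (3 + (m1 + (m2 + (d1 + i))))  ≡⟨ below-+ 3 centreAt decode₁ (m1 + (m2 + (d1 + i))) ⟩
    decode₁ (m1 + (m2 + (d1 + i)))       ≡⟨ below-+ m1 mid₁ decode₂ (m2 + (d1 + i)) ⟩
    decode₂ (m2 + (d1 + i))              ≡⟨ below-+ m2 mid₂At decode₃ (d1 + i) ⟩
    decode₃ (d1 + i)                     ≡⟨ below-+ d1 leaf₁ decode₄ i ⟩
    decode₄ i                            ≡⟨ below-< d2 leaf₂ leaf₃ i<d2 ⟩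
    leaf₂ i                              ∎
    where
    reassociate : m1 + m2 + d1 + i ≡ m1 + (m2 + (d1 + i))
    reassociate = trans (+-assoc (m1 + m2) d1 i) (+-assoc m1 m2 (d1 + i))
  decode-val (leaf₃ i) _ = begin
    decode (3 + (m1 + m2 + d1 + d2 + i))        ≡⟨ cong (decode ∘ (3 +_)) reassociate ⟩
    decode (3 + (m1 + (m2 + (d1 + (d2 + i)))))  ≡⟨ below-+ 3 centreAt decode₁ (m1 + (m2 + (d1 + (d2 + i)))) ⟩
    decode₁ (m1 + (m2 + (d1 + (d2 + i))))       ≡⟨ below-+ m1 mid₁ decode₂ (m2 + (d1 + (d2 + i))) ⟩
    decode₂ (m2 + (d1 + (d2 + i)))              ≡⟨ below-+ m2 mid₂At decode₃ (d1 + (d2 + i)) ⟩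
    decode₃ (d1 + (d2 + i))                     ≡⟨ below-+ d1 leaf₁ decode₄ (d2 + i) ⟩
    decode₄ (d2 + i)                            ≡⟨ below-+ d2 leaf₂ leaf₃ i ⟩
    leaf₃ i                                     ∎
    where
    reassociate : m1 + m2 + d1 + d2 + i ≡ m1 + (m2 + (d1 + (d2 + i)))
    reassociate = trans (+-assoc (m1 + m2 + d1) d2 i)
                        (trans (+-assoc (m1 + m2) d1 (d2 + i)) (+-assoc m1 m2 (d1 + (d2 + i))))

  val-injective : ∀ {l l′} → Valid l → Valid l′ → val l ≡ val l′ → l ≡ l′
  val-injective {l} {l′} v v′ e = trans (sym (decode-val l v)) (trans (cong decode e) (decode-val l′ v′))

  leaves-end≤order : ∀ t → start t + size t ≤ order
  leaves-end≤order t = ≤-trans (≤-last t) (≤-reflexive (order-rearranged d1 m1 d2 m2 d3))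
    where
    ≤-last : ∀ t → start t + size t ≤ start 2F + d3
    ≤-last 0F = ≤-trans (m≤m+n (start 1F) d2) (m≤m+n (start 2F) d3)
    ≤-last 1F = m≤m+n (start 2F) d3
    ≤-last 2F = ≤-refl

  paths-end≤order : 3 + m1 + m2 ≤ order
  paths-end≤order = ≤-trans (m≤m+n (start 0F) d1) (leaves-end≤order 0F)

  val<order : ∀ l → Valid l → val l < order
  val<order (centre t) _ = <-≤-trans (toℕ<n t) (≤-trans (m≤m+n 3 (m1 + m2)) paths-end≤order)
  val<order (mid₁ i) i<m1 = <-≤-trans (+-monoʳ-< 3 i<m1) (≤-trans (m≤m+n (3 + m1) m2) paths-end≤order)
  val<order (mid₂ i) i<m2 = <-≤-trans (+-monoʳ-< (3 + m1) (m∸[1+i]<m i<m2)) paths-end≤order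
  val<order (leaf t i) i<d = <-≤-trans (+-monoʳ-< (start t) i<d) (leaves-end≤order t)

open import Data.List.Relation.Unary.Unique.DecPropositional _≟ₗ_ using (unique?)

module Tree (d1 m1 d2 m2 d3 : ℕ) (χ : Coloring (C-order d1 m1 d2 m2 d3)) (χ-sym : Symmetric χ) where

  open Layout d1 m1 d2 m2 d3 public
  open Weights χ χ-sym public

  Injective : Labelling → Set
  Injective = InjectiveOn order

  placed-apart : ∀ {h} → Injective h → ∀ {l l′} → Valid l → Valid l′ → l ≢ l′ →
                 h (val l) ≢ h (val l′)
  placed-apart h-inj {l} {l′} v v′ l≢l′ e =
    l≢l′ (val-injective v v′ (h-inj (val l) (val l′) (val<order l v) (val<order l′ v′) e))

  transpose-preserves-injective : ∀ {h} z w → Injective h → Injective (transpose z w ∘ h)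
  transpose-preserves-injective z w h-inj i j i<n j<n e = h-inj i j i<n j<n (transpose-injective z w e)

  ZeroSumCopy : Set
  ZeroSumCopy = HasZeroSumCopy d1 m1 d2 m2 d3 χ

  -- Every step of the argument either exhibits a zero-sum copy or establishes its claim, which
  -- keeps the proof by contradiction constructive.
  open RawMonad (Sumₗ.monad ZeroSumCopy 0ℓ) using (pure; _>>=_)

  edges : List (ℕ × ℕ)
  edges = C-edges d1 m1 d2 m2 d3

  path₁ path₂ : List (ℕ × ℕ)
  path₁ = pathEdges 0 1 3 m1
  path₂ = pathEdges 1 2 (3 + m1) m2

  zero-sum-or-nonzero : ∀ h → Injective h → ZeroSumCopy ⊎ (weight h edges ≢ 0F)
  zero-sum-or-nonzero h h-inj with weight h edges ≟ 0F
  ... | yes w≡0 = inj₁ (h , h-inj , trans (edgeColorSum≡weight h edges) (cong toℕ w≡0))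
  ... | no w≢0 = inj₂ w≢0

  -- The weights of g, (b d) ∘ g, (z w) ∘ g and (b d) ∘ (z w) ∘ g are t, t ⊕ δ, t ⊕ ε, t ⊕ ε ⊕ δ.
  commuting-swaps : ∀ g → Injective g → ∀ {b d z w δ} → δ ≢ 0F →
    swapDelta b d g edges ≡ δ → swapDelta b d (transpose z w ∘ g) edges ≡ δ →
    ZeroSumCopy ⊎ (swapDelta z w g edges ≡ 0F)
  commuting-swaps g g-inj {b} {d} {z} {w} {δ} δ≢0 bd-g bd-g′ = do
    t≢0 ← zero-sum-or-nonzero g g-inj
    tδ≢0 ← zero-sum-or-nonzero (transpose b d ∘ g) (transpose-preserves-injective b d g-inj)
    tε≢0 ← zero-sum-or-nonzero g′ g′-inj
    tεδ≢0 ← zero-sum-or-nonzero (transpose b d ∘ g′) (transpose-preserves-injective b d g′-inj)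
    pure (four-nonzero⇒≡0 t δ ε δ≢0 t≢0
      (tδ≢0 ∘ trans (trans (weight-transpose b d g edges) (cong (t ⊕_) bd-g)))
      (tε≢0 ∘ trans (weight-transpose z w g edges))
      (tεδ≢0 ∘ trans (trans (weight-transpose b d g′ edges)
                            (cong₂ _⊕_ (weight-transpose z w g edges) bd-g′))))
    where
    g′ : Labelling
    g′ = transpose z w ∘ g
    g′-inj : Injective g′
    g′-inj = transpose-preserves-injective z w g-inj
    t : ℤ₃
    t = weight g edges
    ε : ℤ₃
    ε = swapDelta z w g edges

  Placement : Set
  Placement = List (Label × Fin order)

  Realises : Labelling → Placement → Set
  Realises h = All (λ (l , v) → h (val l) ≡ v)

  identityLabelling : Labelling
  identityLabelling i with i <? order
  ... | yes i<order = fromℕ< i<order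
  ... | no _ = fromℕ< (val<order p₁ tt)

  toℕ-identityLabelling : ∀ {i} → i < order → toℕ (identityLabelling i) ≡ i
  toℕ-identityLabelling {i} i<order with i <? order
  ... | yes p = toℕ-fromℕ< p
  ... | no ¬p = ⊥-elim (¬p i<order)

  identityLabelling-injective : Injective identityLabelling
  identityLabelling-injective i j i<n j<n e = trans (sym (toℕ-identityLabelling i<n)) (trans (cong toℕ e) (toℕ-identityLabelling j<n))

  realise : (ps : Placement) → All Valid (map proj₁ ps) → Unique (map proj₁ ps) → Unique (map proj₂ ps) →
            Σ Labelling λ h → Injective h × Realises h ps
  realise [] _ _ _ = identityLabelling , identityLabelling-injective , []
  realise ((l , v) ∷ ps) (vl ∷ vls) (l∉ ∷ ls-unique) (v∉ ∷ vs-unique) with realise ps vls ls-unique vs-unique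
  ... | g , g-inj , g-realises =
    transpose (g (val l)) v ∘ g , transpose-preserves-injective (g (val l)) v g-inj ,
    transpose-matchˡ (g (val l)) v ∷ keep ps vls l∉ v∉ g-realises
    where
    keep : ∀ ps → All Valid (map proj₁ ps) → All (l ≢_) (map proj₁ ps) → All (v ≢_) (map proj₂ ps) →
           Realises g ps → Realises (transpose (g (val l)) v ∘ g) ps
    keep [] _ _ _ _ = []
    keep ((l′ , v′) ∷ ps) (vl′ ∷ vls) (l≢l′ ∷ l∉) (v≢v′ ∷ v∉) (e ∷ es) =
      trans (cong (transpose (g (val l)) v) e)
            (transpose-other (g (val l)) v (λ v′≡ → placed-apart g-inj vl vl′ l≢l′ (sym (trans e v′≡)))
                                           (v≢v′ ∘ sym))
      ∷ keep ps vls l∉ v∉ es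

  module Swapping (h : Labelling) (h-inj : Injective h) {L₁ L₂ : Label} (v₁ : Valid L₁) (v₂ : Valid L₂) where

    z w : Fin order
    z = h (val L₁)
    w = h (val L₂)

    -- Stated by decision, so that for labels built from different constructors (or different
    -- numerals) the implicit Untouched arguments below are found by evaluation.
    Untouched : Label → Set
    Untouched l = False (l ≟ₗ L₁) × False (l ≟ₗ L₂)

    avoid : ∀ l → Valid l → Untouched l → Avoids z w (h (val l))
    avoid _ v (l≢L₁ , l≢L₂) =
      placed-apart h-inj v v₁ (toWitnessFalse l≢L₁) , placed-apart h-inj v v₂ (toWitnessFalse l≢L₂)

    starDelta : Fin 3 → ℤ₃
    starDelta t = ∑ (size t) (λ i → Δ z w (h (toℕ t)) (h (start t + i)))

    swapDelta-pieces : ∀ {x₁ x₂ y₁ y₂ y₃} →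
      swapDelta z w h path₁ ≡ x₁ → swapDelta z w h path₂ ≡ x₂ →
      starDelta 0F ≡ y₁ → starDelta 1F ≡ y₂ → starDelta 2F ≡ y₃ →
      swapDelta z w h edges ≡ x₁ ⊕ (x₂ ⊕ (y₁ ⊕ (y₂ ⊕ y₃)))
    swapDelta-pieces e₁ e₂ e₃ e₄ e₅ =
      trans (edgeSum-++ δ path₁ _) (cong₂ _⊕_ e₁
      (trans (edgeSum-++ δ path₂ _) (cong₂ _⊕_ e₂
      (trans (edgeSum-++ δ (starEdges 0 (start 0F) d1) _) (cong₂ _⊕_ (trans (edgeSum-star δ 0 _ d1) e₃)
      (trans (edgeSum-++ δ (starEdges 1 (start 1F) d2) _)
             (cong₂ _⊕_ (trans (edgeSum-star δ 1 _ d2) e₄) (trans (edgeSum-star δ 2 _ d3) e₅))))))))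
      where
      δ : ℕ → ℕ → ℤ₃
      δ i j = Δ z w (h i) (h j)

    path₁-untouched : {_ : Untouched p₁} {_ : Untouched p₂} {_ : ∀ i → Untouched (mid₁ i)} →
      swapDelta z w h path₁ ≡ 0F
    path₁-untouched {u₁} {u₂} {u} =
      swapDelta-path-untouched h 0 1 3 m1 (avoid p₁ tt u₁) (avoid p₂ tt u₂) λ i i<m1 →
        avoid (mid₁ i) i<m1 (u i)

    mid₂-position : ∀ {i} → i < m2 → val (mid₂ (m2 ∸ suc i)) ≡ 3 + m1 + i
    mid₂-position i<m2 = cong (3 + m1 +_) (m∸[1+[m∸[1+i]]]≡i i<m2)

    avoid-path₂ : ∀ {k} → k ≤ m2 → (∀ i → i < k → Untouched (mid₂ (m2 ∸ suc i))) →
                  AvoidsRange h (3 + m1) k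
    avoid-path₂ k≤m2 u i i<k =
      subst (Avoids z w ∘ h) (mid₂-position i<m2) (avoid (mid₂ _) (m∸[1+i]<m i<m2) (u i i<k))
      where
      i<m2 : i < m2
      i<m2 = <-≤-trans i<k k≤m2

    path₂-untouched : {_ : Untouched p₂} {_ : Untouched p₃} {_ : ∀ i → Untouched (mid₂ i)} →
      swapDelta z w h path₂ ≡ 0F
    path₂-untouched {u₂} {u₃} {u} =
      swapDelta-path-untouched h 1 2 (3 + m1) m2 (avoid p₂ tt u₂) (avoid p₃ tt u₃)
                               (avoid-path₂ ≤-refl λ _ _ → u _)

    star-untouched : ∀ t {_ : Untouched (centre t)} {_ : ∀ i → Untouched (leaf t i)} → starDelta t ≡ 0F
    star-untouched t {uc} {ul} =
      ∑-zero (size t) λ i i<d → Δ-untouched (avoid (centre t) tt uc) (avoid (leaf t i) i<d (ul i))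

    star-hit : ∀ t {k} → k < size t → {_ : Untouched (centre t)} →
      (∀ i → i ≢ k → Untouched (leaf t i)) → starDelta t ≡ Δ z w (h (toℕ t)) (h (start t + k))
    star-hit t k<d {uc} ul = ∑-single (size t) k<d λ i i<d i≢k →
      Δ-untouched (avoid (centre t) tt uc) (avoid (leaf t i) i<d (ul i i≢k))

  private
    two-hits : ∀ A B → 0F ⊕ (0F ⊕ (A ⊕ (B ⊕ 0F))) ≡ A ⊕ B
    two-hits = solve-∀ ℤ₃-ring

    two-outer-hits : ∀ A B → 0F ⊕ (0F ⊕ (A ⊕ (0F ⊕ B))) ≡ A ⊕ B
    two-outer-hits = solve-∀ ℤ₃-ring

    two-last-hits : ∀ A B → 0F ⊕ (0F ⊕ (0F ⊕ (A ⊕ B))) ≡ A ⊕ B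
    two-last-hits = solve-∀ ℤ₃-ring

  leaf-swap₁₂ : ∀ {h} → Injective h → ∀ {i j x u y v} → i < d1 → j < d2 →
    h 0 ≡ x → h (val (leaf₁ i)) ≡ u → h 1 ≡ y → h (val (leaf₂ j)) ≡ v →
    swapDelta u v h edges ≡ (χ x v ⊖ χ x u) ⊕ (χ y u ⊖ χ y v)
  leaf-swap₁₂ {h} h-inj {i} {j} {x} {u} {y} {v} i<d1 j<d2 refl refl refl refl =
    trans (swapDelta-pieces path₁-untouched path₂-untouched
             (trans (star-hit 0F i<d1 λ _ i′≢i → leaf-other i′≢i , _) (Δ-vz (avoid (centre _) tt _)))
             (trans (star-hit 1F j<d2 λ _ j′≢j → _ , leaf-other j′≢j) (Δ-vw (avoid (centre _) tt _)))
             (star-untouched 2F))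
          (two-hits (χ x v ⊖ χ x u) (χ y u ⊖ χ y v))
    where open Swapping h h-inj {leaf₁ i} {leaf₂ j} i<d1 j<d2

  leaf-swap₁₃ : ∀ {h} → Injective h → ∀ {i j x u y v} → i < d1 → j < d3 →
    h 0 ≡ x → h (val (leaf₁ i)) ≡ u → h 2 ≡ y → h (val (leaf₃ j)) ≡ v →
    swapDelta u v h edges ≡ (χ x v ⊖ χ x u) ⊕ (χ y u ⊖ χ y v)
  leaf-swap₁₃ {h} h-inj {i} {j} {x} {u} {y} {v} i<d1 j<d3 refl refl refl refl =
    trans (swapDelta-pieces path₁-untouched path₂-untouched
             (trans (star-hit 0F i<d1 λ _ i′≢i → leaf-other i′≢i , _) (Δ-vz (avoid (centre _) tt _)))
             (star-untouched 1F)
             (trans (star-hit 2F j<d3 λ _ j′≢j → _ , leaf-other j′≢j) (Δ-vw (avoid (centre _) tt _))))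
          (two-outer-hits (χ x v ⊖ χ x u) (χ y u ⊖ χ y v))
    where open Swapping h h-inj {leaf₁ i} {leaf₃ j} i<d1 j<d3

  leaf-swap₂₃ : ∀ {h} → Injective h → ∀ {i j x u y v} → i < d2 → j < d3 →
    h 1 ≡ x → h (val (leaf₂ i)) ≡ u → h 2 ≡ y → h (val (leaf₃ j)) ≡ v →
    swapDelta u v h edges ≡ (χ x v ⊖ χ x u) ⊕ (χ y u ⊖ χ y v)
  leaf-swap₂₃ {h} h-inj {i} {j} {x} {u} {y} {v} i<d2 j<d3 refl refl refl refl =
    trans (swapDelta-pieces path₁-untouched path₂-untouched
             (star-untouched 0F)
             (trans (star-hit 1F i<d2 λ _ i′≢i → leaf-other i′≢i , _) (Δ-vz (avoid (centre _) tt _)))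
             (trans (star-hit 2F j<d3 λ _ j′≢j → _ , leaf-other j′≢j) (Δ-vw (avoid (centre _) tt _))))
          (two-last-hits (χ x v ⊖ χ x u) (χ y u ⊖ χ y v))
    where open Swapping h h-inj {leaf₂ i} {leaf₃ j} i<d2 j<d3

  centre-leaf-swap-star : ∀ h (h-inj : Injective h) t {κ} (d>0 : 0 < size t) →
    let open Swapping h h-inj {centre t} {leaf t 0} tt d>0 in
    (∀ i → i < size t → i ≢ 0 → χ (h (val (leaf t i))) w ⊖ χ (h (val (leaf t i))) z ≡ κ) →
    κ ⊕ starDelta t ≡ size t · κ
  centre-leaf-swap-star h h-inj t d>0 leaves = ∑-all-but-one (size t) d>0 Δ-zw λ i i<d i≢0 →
    trans (Δ-zv (avoid (leaf t i) i<d (_ , leaf-other i≢0))) (leaves i i<d i≢0)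
    where open Swapping h h-inj {centre t} {leaf t 0} tt d>0

  SameDifferencesAs : C4 order → Fin order → Set
  SameDifferencesAs C v = ∀ {t p q} → OffCycle C t → OffCycle C p → OffCycle C q →
    t ≢ p → t ≢ q → p ≢ q → ZeroSumCopy ⊎ (χ t q ⊖ χ t p ≡ χ v q ⊖ χ v p)

  MonochromaticFrom : C4 order → Fin order → Set
  MonochromaticFrom C v = ∀ {p q} → OffCycle C p → OffCycle C q → p ≢ q → ZeroSumCopy ⊎ (χ v q ≡ χ v p)

  record CycleEmbedding (C : C4 order) : Set where
    field
      la lb lc ld : Label
      valid : All Valid (la ∷ lb ∷ lc ∷ ld ∷ [])
      defect-swap : ∀ h → Injective h →
        Realises h ((la , a C) ∷ (lb , b C) ∷ (lc , c C) ∷ (ld , d C) ∷ []) →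
        swapDelta (b C) (d C) h edges ≡ defect C

  cycle₁₂ : ∀ C → 0 < d1 → 0 < d2 → CycleEmbedding C
  cycle₁₂ C d1>0 d2>0 = record
    { la = p₁ ; lb = leaf₁ 0 ; lc = p₂ ; ld = leaf₂ 0 ; valid = tt ∷ d1>0 ∷ tt ∷ d2>0 ∷ []
    ; defect-swap = λ { h h-inj (ea ∷ eb ∷ ec ∷ ed ∷ []) → leaf-swap₁₂ h-inj d1>0 d2>0 ea eb ec ed } }

  cycle₁₃ : ∀ C → 0 < d1 → 0 < d3 → CycleEmbedding C
  cycle₁₃ C d1>0 d3>0 = record
    { la = p₁ ; lb = leaf₁ 0 ; lc = p₃ ; ld = leaf₃ 0 ; valid = tt ∷ d1>0 ∷ tt ∷ d3>0 ∷ []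
    ; defect-swap = λ { h h-inj (ea ∷ eb ∷ ec ∷ ed ∷ []) → leaf-swap₁₃ h-inj d1>0 d3>0 ea eb ec ed } }

  cycle₂₃ : ∀ C → 0 < d2 → 0 < d3 → CycleEmbedding C
  cycle₂₃ C d2>0 d3>0 = record
    { la = p₂ ; lb = leaf₂ 0 ; lc = p₃ ; ld = leaf₃ 0 ; valid = tt ∷ d2>0 ∷ tt ∷ d3>0 ∷ []
    ; defect-swap = λ { h h-inj (ea ∷ eb ∷ ec ∷ ed ∷ []) → leaf-swap₂₃ h-inj d2>0 d3>0 ea eb ec ed } }

  cycle-distinct : ∀ (C : C4 order) {vs} → All (OffCycle C) vs → Unique vs →
                   Unique (a C ∷ b C ∷ c C ∷ d C ∷ vs)
  cycle-distinct C off distinct =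
    (ab C ∷ ac C ∷ ad C ∷ All.map (λ (v≢a , _) → v≢a ∘ sym) off) ∷
    (bc C ∷ bd C ∷ All.map (λ (_ , v≢b , _) → v≢b ∘ sym) off) ∷
    (cd C ∷ All.map (λ (_ , _ , v≢c , _) → v≢c ∘ sym) off) ∷
    All.map (λ (_ , _ , _ , v≢d) → v≢d ∘ sym) off ∷ distinct

  module _ {C : C4 order} (E : CycleEmbedding C) where
    open CycleEmbedding E

    placement : Placement → Placement
    placement ws = (la , a C) ∷ (lb , b C) ∷ (lc , c C) ∷ (ld , d C) ∷ ws

    cycleLabels : List Label
    cycleLabels = la ∷ lb ∷ lc ∷ ld ∷ []

    -- The swap of z and w moves no vertex of the cycle, so it commutes with the swap of b and d,
    -- which changes the weight by the defect of C.
    swap-vanishes : Alternating χ C → ∀ Lz z Lw w rest {X} →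
      {_ : True (unique? (cycleLabels ++ Lz ∷ Lw ∷ map proj₁ rest))} →
      All Valid (Lz ∷ Lw ∷ map proj₁ rest) →
      All (OffCycle C) (z ∷ w ∷ map proj₂ rest) → Unique (z ∷ w ∷ map proj₂ rest) →
      (∀ h → Injective h → Realises h (placement ((Lz , z) ∷ (Lw , w) ∷ rest)) →
             ZeroSumCopy ⊎ (swapDelta z w h edges ≡ X)) →
      ZeroSumCopy ⊎ (X ≡ 0F)
    swap-vanishes alt Lz z Lw w rest {_} {labels-unique} valid-ws off-cycle@(z-off ∷ w-off ∷ _) distinct formula
      with realise (placement ((Lz , z) ∷ (Lw , w) ∷ rest)) (++⁺ valid valid-ws) (toWitness labels-unique)
                   (cycle-distinct C off-cycle distinct)
    ... | g , g-inj , realises@(ea ∷ eb ∷ ec ∷ ed ∷ _) = do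
      swap≡X ← formula g g-inj realises
      swap≡0 ← commuting-swaps g g-inj (alternating⇒defect≢0 C alt)
                 (defect-swap g g-inj (ea ∷ eb ∷ ec ∷ ed ∷ []))
                 (defect-swap (transpose z w ∘ g) (transpose-preserves-injective z w g-inj)
                    (stays la ea proj₁ ∷ stays lb eb (proj₁ ∘ proj₂) ∷
                     stays lc ec (proj₁ ∘ proj₂ ∘ proj₂) ∷
                     stays ld ed (proj₂ ∘ proj₂ ∘ proj₂) ∷ []))
      pure (trans (sym swap≡X) swap≡0)
      where
      stays : ∀ l {v} → g (val l) ≡ v → (∀ {u} → OffCycle C u → u ≢ v) →
              transpose z w (g (val l)) ≡ v
      stays _ e off = trans (cong (transpose z w) e) (transpose-other z w (off z-off ∘ sym) (off w-off ∘ sym))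

    placed-off-cycle : ∀ {h} → Injective h → ∀ {ws} → Realises h (placement ws) → ∀ l → Valid l →
      {_ : False (l ≟ₗ la)} {_ : False (l ≟ₗ lb)} {_ : False (l ≟ₗ lc)} {_ : False (l ≟ₗ ld)} →
      OffCycle C (h (val l))
    placed-off-cycle {h} h-inj (ea ∷ eb ∷ ec ∷ ed ∷ _) l vl {l≢la} {l≢lb} {l≢lc} {l≢ld} with valid
    ... | va ∷ vb ∷ vc ∷ vd ∷ [] =
      apart ea va l≢la , apart eb vb l≢lb , apart ec vc l≢lc , apart ed vd l≢ld
      where
      apart : ∀ {l′ v} → h (val l′) ≡ v → Valid l′ → False (l ≟ₗ l′) → h (val l) ≢ v
      apart e vl′ l≢l′ hl≡v = placed-apart h-inj vl vl′ (toWitnessFalse l≢l′) (trans hl≡v (sym e))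

    centre-leaf-swap : ∀ {v} → SameDifferencesAs C v →
      ∀ {h ws} (h-inj : Injective h) → Realises h (placement ws) → ∀ t (d>0 : 0 < size t) →
      {_ : ∀ i → False (leaf t i ≟ₗ la)} {_ : ∀ i → False (leaf t i ≟ₗ lb)}
      {_ : ∀ i → False (leaf t i ≟ₗ lc)} {_ : ∀ i → False (leaf t i ≟ₗ ld)} →
      let open Swapping h h-inj {centre t} {leaf t 0} tt d>0 in
      OffCycle C z → OffCycle C w →
      ZeroSumCopy ⊎ ((χ v w ⊖ χ v z) ⊕ starDelta t ≡ size t · (χ v w ⊖ χ v z))
    centre-leaf-swap {v} same {h} h-inj realises t d>0 {≢la} {≢lb} {≢lc} {≢ld} z-off w-off = do
      leaves ← sequence< (size t) leaf-agrees
      pure (centre-leaf-swap-star h h-inj t d>0 leaves)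
      where
      z w : Fin order
      z = h (toℕ t)
      w = h (val (leaf t 0))
      leaf-agrees : ∀ i → i < size t →
        ZeroSumCopy ⊎ (i ≢ 0 → χ (h (val (leaf t i))) w ⊖ χ (h (val (leaf t i))) z ≡ χ v w ⊖ χ v z)
      leaf-agrees zero _ = pure λ 0≢0 → ⊥-elim (0≢0 refl)
      leaf-agrees (suc i) i<d = do
        agrees ← same (placed-off-cycle h-inj realises (leaf t (suc i)) i<d
                                        {≢la (suc i)} {≢lb (suc i)} {≢lc (suc i)} {≢ld (suc i)})
                      z-off w-off (placed-apart h-inj {leaf t (suc i)} {centre t} i<d tt λ ())
                      (placed-apart h-inj {leaf t (suc i)} {leaf t 0} i<d d>0 λ ())
                      (placed-apart h-inj {centre t} {leaf t 0} tt d>0 λ ())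
        pure λ _ → agrees

  MonochromaticStars : C4 order → Set
  MonochromaticStars C = ∀ {Y z w} → OffCycle C Y → OffCycle C z → OffCycle C w →
    Y ≢ z → Y ≢ w → z ≢ w → ZeroSumCopy ⊎ (χ Y z ≡ χ Y w)

  monochromatic-stars⇒zero-sum : ∀ {C} → MonochromaticStars C → NotMonoOff χ C → ZeroSumCopy
  monochromatic-stars⇒zero-sum {C} stars (u , v , x , y , u-off , v-off , x-off , y-off , u≢v , x≢y , uv≢xy) =
    [ id , ⊥-elim ∘ uv≢xy ]′ same-colour
    where
    star : ∀ {Y z w} → OffCycle C Y → OffCycle C z → OffCycle C w → Y ≢ z → Y ≢ w →
           ZeroSumCopy ⊎ (χ Y z ≡ χ Y w)
    star {z = z} {w} Y-off z-off w-off Y≢z Y≢w with z ≟ w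
    ... | yes refl = pure refl
    ... | no z≢w = stars Y-off z-off w-off Y≢z Y≢w z≢w
    same-colour : ZeroSumCopy ⊎ (χ u v ≡ χ x y)
    same-colour with x ≟ u
    ... | yes refl = star x-off v-off y-off u≢v x≢y
    ... | no x≢u = do
      uv≡ux ← star u-off v-off x-off u≢v (x≢u ∘ sym)
      xu≡xy ← star x-off u-off y-off x≢u x≢y
      pure (trans uv≡ux (trans (χ-sym u x) xu≡xy))

  -- Used with z and w placed so that, apart from each other, their neighbours in F are the same
  -- except for one more neighbour Y of z; the swap then changes the weight by χ Y w ⊖ χ Y z.
  stars-from-swap : ∀ {C} (E : CycleEmbedding C) → Alternating χ C → ∀ Lz Lw LY →
    {_ : True (unique? (cycleLabels E ++ Lz ∷ Lw ∷ LY ∷ []))} →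
    Valid Lz → Valid Lw → Valid LY →
    (∀ {Y z w} h → Injective h → Realises h (placement E ((Lz , z) ∷ (Lw , w) ∷ (LY , Y) ∷ [])) →
                   swapDelta z w h edges ≡ χ Y w ⊖ χ Y z) →
    MonochromaticStars C
  stars-from-swap E alt Lz Lw LY {labels-unique} vz vw vY formula {Y} {z} {w}
                  Y-off z-off w-off Y≢z Y≢w z≢w = do
    Yw⊖Yz≡0 ← swap-vanishes E alt Lz z Lw w ((LY , Y) ∷ []) {_} {labels-unique} (vz ∷ vw ∷ vY ∷ [])
                 (z-off ∷ w-off ∷ Y-off ∷ [])
                 ((z≢w ∷ (Y≢z ∘ sym) ∷ []) ∷ ((Y≢w ∘ sym) ∷ []) ∷ [] ∷ [])
                 λ h h-inj realises → pure (formula h h-inj realises)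
    pure (sym (x⊖y≡0⇒x≡y (χ Y w) (χ Y z) Yw⊖Yz≡0))

  stars-from-transfer : ∀ {C} v → SameDifferencesAs C v → MonochromaticFrom C v → MonochromaticStars C
  stars-from-transfer v transfer uniform {Y} {z} {w} Y-off z-off w-off Y≢z Y≢w z≢w = do
    Y-like-v ← transfer Y-off z-off w-off Y≢z Y≢w z≢w
    vw≡vz ← uniform z-off w-off z≢w
    pure (sym (x⊖y≡0⇒x≡y (χ Y w) (χ Y z)
                 (trans Y-like-v (trans (cong (_⊖ χ v z) vw≡vz) (x⊖x≡0 (χ v z))))))

  module _ {C : C4 order} (alt : Alternating χ C) (d1>0 : 0 < d1) (d3>0 : 0 < d3) where

    transfer-to-c : 0 < d2 → 1 < d3 → SameDifferencesAs C (c C)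
    transfer-to-c d2>0 d3>1 {t} {p} {q} t-off p-off q-off t≢p t≢q p≢q = do
      swap≡0 ← swap-vanishes (cycle₁₃ C d1>0 d3>0) alt (leaf₂ 0) p (leaf₃ 1) q ((p₂ , t) ∷ [])
                 (d2>0 ∷ d3>1 ∷ tt ∷ []) (p-off ∷ q-off ∷ t-off ∷ [])
                 ((p≢q ∷ (t≢p ∘ sym) ∷ []) ∷ ((t≢q ∘ sym) ∷ []) ∷ [] ∷ []) formula
      pure (x⊕[y⊖z]≡0⇒x≡z⊖y (χ t q ⊖ χ t p) (χ (c C) p) (χ (c C) q) swap≡0)
      where
      formula : ∀ h → Injective h →
        Realises h (placement (cycle₁₃ C d1>0 d3>0) ((leaf₂ 0 , p) ∷ (leaf₃ 1 , q) ∷ (p₂ , t) ∷ [])) →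
        ZeroSumCopy ⊎ (swapDelta p q h edges ≡ (χ t q ⊖ χ t p) ⊕ (χ (c C) p ⊖ χ (c C) q))
      formula h h-inj (_ ∷ _ ∷ ec ∷ _ ∷ ep ∷ eq ∷ et ∷ []) =
        pure (leaf-swap₂₃ h-inj d2>0 d3>1 et ep ec eq)

    transfer-to-a : 0 < d2 → 1 < d1 → SameDifferencesAs C (a C)
    transfer-to-a d2>0 d1>1 {t} {p} {q} t-off p-off q-off t≢p t≢q p≢q = do
      swap≡0 ← swap-vanishes (cycle₁₃ C d1>0 d3>0) alt (leaf₁ 1) q (leaf₂ 0) p ((p₂ , t) ∷ [])
                 (d1>1 ∷ d2>0 ∷ tt ∷ []) (q-off ∷ p-off ∷ t-off ∷ [])
                 (((p≢q ∘ sym) ∷ (t≢q ∘ sym) ∷ []) ∷ ((t≢p ∘ sym) ∷ []) ∷ [] ∷ []) formula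
      pure (x⊕[y⊖z]≡0⇒x≡z⊖y (χ t q ⊖ χ t p) (χ (a C) p) (χ (a C) q)
             (trans (⊕-comm (χ t q ⊖ χ t p) (χ (a C) p ⊖ χ (a C) q)) swap≡0))
      where
      formula : ∀ h → Injective h →
        Realises h (placement (cycle₁₃ C d1>0 d3>0) ((leaf₁ 1 , q) ∷ (leaf₂ 0 , p) ∷ (p₂ , t) ∷ [])) →
        ZeroSumCopy ⊎ (swapDelta q p h edges ≡ (χ (a C) p ⊖ χ (a C) q) ⊕ (χ t q ⊖ χ t p))
      formula h h-inj (ea ∷ _ ∷ _ ∷ _ ∷ eq ∷ ep ∷ et ∷ []) =
        pure (leaf-swap₁₂ h-inj d1>1 d2>0 ea eq et ep)

    transfer-a-to-c : 1 < d1 → 1 < d3 → ∀ {p q} → OffCycle C p → OffCycle C q → p ≢ q →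
      ZeroSumCopy ⊎ (χ (a C) q ⊖ χ (a C) p ≡ χ (c C) q ⊖ χ (c C) p)
    transfer-a-to-c d1>1 d3>1 {p} {q} p-off q-off p≢q = do
      swap≡0 ← swap-vanishes (cycle₁₃ C d1>0 d3>0) alt (leaf₁ 1) p (leaf₃ 1) q []
                 (d1>1 ∷ d3>1 ∷ []) (p-off ∷ q-off ∷ []) ((p≢q ∷ []) ∷ [] ∷ []) formula
      pure (x⊕[y⊖z]≡0⇒x≡z⊖y (χ (a C) q ⊖ χ (a C) p) (χ (c C) p) (χ (c C) q) swap≡0)
      where
      formula : ∀ h → Injective h →
        Realises h (placement (cycle₁₃ C d1>0 d3>0) ((leaf₁ 1 , p) ∷ (leaf₃ 1 , q) ∷ [])) →
        ZeroSumCopy ⊎ (swapDelta p q h edges ≡ (χ (a C) q ⊖ χ (a C) p) ⊕ (χ (c C) p ⊖ χ (c C) q))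
      formula h h-inj (ea ∷ _ ∷ ec ∷ _ ∷ ep ∷ eq ∷ []) = pure (leaf-swap₁₃ h-inj d1>1 d3>1 ea ep ec eq)

module SingleLeafAtP₁
  (m d2 m2 d3 : ℕ) (χ : Coloring (C-order 1 (suc m) d2 m2 d3)) (χ-sym : Symmetric χ)
  (d2>0 : 0 < d2) (d3>0 : 0 < d3) {C : C4 (C-order 1 (suc m) d2 m2 d3)} (alt : Alternating χ C)
  where

  open Tree 1 (suc m) d2 m2 d3 χ χ-sym

  cycle : CycleEmbedding C
  cycle = cycle₂₃ C d2>0 d3>0

  swap-formula : ∀ {Y z w} h → Injective h →
    Realises h (placement cycle ((p₁ , z) ∷ (leaf₁ 0 , w) ∷ (mid₁ 0 , Y) ∷ [])) →
    swapDelta z w h edges ≡ χ Y w ⊖ χ Y z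
  swap-formula h h-inj (_ ∷ _ ∷ _ ∷ _ ∷ refl ∷ refl ∷ refl ∷ []) = begin
    swapDelta z w h edges
      ≡⟨ swapDelta-pieces
           (cong₂ _⊕_ (Δ-zv (avoid (mid₁ 0) z<s _))
                      (swapDelta-path-untouched h 3 1 4 m (avoid (mid₁ 0) z<s _) (avoid p₂ tt _)
                                                λ i i<m → avoid (mid₁ (suc i)) (s<s i<m) _))
           path₂-untouched (trans (⊕-identityʳ (Δ z w z w)) Δ-zw) (star-untouched 1F) (star-untouched 2F) ⟩
    (χ Y w ⊖ χ Y z ⊕ 0F) ⊕ (0F ⊕ (0F ⊕ (0F ⊕ 0F)))
      ≡⟨ only-path₁ (χ Y w ⊖ χ Y z) ⟩
    χ Y w ⊖ χ Y z ∎
    where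
    open Swapping h h-inj {p₁} {leaf₁ 0} tt z<s
    Y : Fin order
    Y = h 3
    only-path₁ : ∀ X → (X ⊕ 0F) ⊕ (0F ⊕ (0F ⊕ (0F ⊕ 0F))) ≡ X
    only-path₁ = solve-∀ ℤ₃-ring

  stars : MonochromaticStars C
  stars = stars-from-swap cycle alt p₁ (leaf₁ 0) (mid₁ 0) tt z<s z<s swap-formula

module SingleLeafAtP₃
  (d1 m1 d2 m : ℕ) (χ : Coloring (C-order d1 m1 d2 (suc m) 1)) (χ-sym : Symmetric χ)
  (d1>0 : 0 < d1) (d2>0 : 0 < d2) {C : C4 (C-order d1 m1 d2 (suc m) 1)} (alt : Alternating χ C)
  where

  open Tree d1 m1 d2 (suc m) 1 χ χ-sym

  cycle : CycleEmbedding C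
  cycle = cycle₁₂ C d1>0 d2>0

  swap-formula : ∀ {Y z w} h → Injective h →
    Realises h (placement cycle ((p₃ , z) ∷ (leaf₃ 0 , w) ∷ (mid₂ 0 , Y) ∷ [])) →
    swapDelta z w h edges ≡ χ Y w ⊖ χ Y z
  swap-formula h h-inj (_ ∷ _ ∷ _ ∷ _ ∷ refl ∷ refl ∷ refl ∷ []) = begin
    swapDelta z w h edges
      ≡⟨ swapDelta-pieces path₁-untouched
           (trans (swapDelta-path-end h 1 2 (3 + m1) (suc m) (avoid p₂ tt _) (avoid-path₂ ≤-refl λ _ _ → _))
                  (Δ-vz (avoid (mid₂ 0) z<s _)))
           (star-untouched 0F) (star-untouched 1F) (trans (⊕-identityʳ (Δ z w z w)) Δ-zw) ⟩
    0F ⊕ ((χ Y w ⊖ χ Y z) ⊕ (0F ⊕ (0F ⊕ 0F)))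
      ≡⟨ only-path₂ (χ Y w ⊖ χ Y z) ⟩
    χ Y w ⊖ χ Y z ∎
    where
    open Swapping h h-inj {p₃} {leaf₃ 0} tt z<s
    Y : Fin order
    Y = h (val (mid₂ 0))
    only-path₂ : ∀ X → 0F ⊕ (X ⊕ (0F ⊕ (0F ⊕ 0F))) ≡ X
    only-path₂ = solve-∀ ℤ₃-ring

  stars : MonochromaticStars C
  stars = stars-from-swap cycle alt p₃ (leaf₃ 0) (mid₂ 0) tt z<s z<s swap-formula

secondOnPath₁ : ℕ → Label
secondOnPath₁ zero = p₂
secondOnPath₁ (suc _) = mid₁ 1

secondOnPath₁-valid : ∀ {d1 d2 m2 d3} m → Layout.Valid d1 (suc m) d2 m2 d3 (secondOnPath₁ m)
secondOnPath₁-valid zero = tt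
secondOnPath₁-valid (suc _) = sz<ss

val-secondOnPath₁ : ∀ {d1 d2 m2 d3} m → pathSecond 1 4 m ≡ Layout.val d1 (suc m) d2 m2 d3 (secondOnPath₁ m)
val-secondOnPath₁ zero = refl
val-secondOnPath₁ (suc _) = refl

secondOnPath₁-apart : ∀ m → False (secondOnPath₁ m ≟ₗ mid₁ 0) × False (secondOnPath₁ m ≟ₗ leaf₁ 1)
secondOnPath₁-apart zero = _
secondOnPath₁-apart (suc _) = _

secondOnPath₁-unique : ∀ m →
  True (unique? (p₁ ∷ leaf₁ 0 ∷ p₃ ∷ leaf₃ 0 ∷ mid₁ 0 ∷ leaf₁ 1 ∷ secondOnPath₁ m ∷ []))
secondOnPath₁-unique zero = _
secondOnPath₁-unique (suc _) = _

module PathNeighbourOfP₁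
  (m d1 d2 m2 d3 : ℕ) (χ : Coloring (C-order d1 (suc m) d2 m2 d3)) (χ-sym : Symmetric χ)
  (d1>1 : 1 < d1) (d3>0 : 0 < d3) {C : C4 (C-order d1 (suc m) d2 m2 d3)} (alt : Alternating χ C)
  where

  open Tree d1 (suc m) d2 m2 d3 χ χ-sym

  cycle : CycleEmbedding C
  cycle = cycle₁₃ C (<⇒≤ d1>1) d3>0

  next : Label
  next = secondOnPath₁ m

  swap-formula : ∀ {Y z w} h → Injective h →
    Realises h (placement cycle ((mid₁ 0 , z) ∷ (leaf₁ 1 , w) ∷ (next , Y) ∷ [])) →
    swapDelta z w h edges ≡ χ Y w ⊖ χ Y z
  swap-formula h h-inj (_ ∷ _ ∷ _ ∷ _ ∷ refl ∷ refl ∷ refl ∷ []) = begin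
    swapDelta z w h edges
      ≡⟨ swapDelta-pieces (cong₂ _⊕_ (Δ-vz (avoid p₁ tt _)) after-z) path₂-untouched
           (trans (star-hit 0F d1>1 λ _ i≢1 → _ , leaf-other i≢1) (Δ-vw (avoid p₁ tt _)))
           (star-untouched 1F) (star-untouched 2F) ⟩
    ((χ P w ⊖ χ P z) ⊕ (χ Y w ⊖ χ Y z)) ⊕ (0F ⊕ ((χ P z ⊖ χ P w) ⊕ (0F ⊕ 0F)))
      ≡⟨ cancelling-hits (χ P w) (χ P z) (χ Y w ⊖ χ Y z) ⟩
    χ Y w ⊖ χ Y z ∎
    where
    open Swapping h h-inj {mid₁ 0} {leaf₁ 1} z<s d1>1
    P : Fin order
    P = h 0
    Y : Fin order
    Y = h (val next)
    after-z : swapDelta z w h (pathEdges 3 1 4 m) ≡ χ Y w ⊖ χ Y z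
    after-z = begin
      swapDelta z w h (pathEdges 3 1 4 m)
        ≡⟨ swapDelta-path-start h 3 1 4 m (avoid p₂ tt _) (λ i i<m → avoid (mid₁ (suc i)) (s<s i<m) _) ⟩
      Δ z w z (h (pathSecond 1 4 m))  ≡⟨ cong (Δ z w z ∘ h) (val-secondOnPath₁ {d1} {d2} {m2} {d3} m) ⟩
      Δ z w z Y                       ≡⟨ Δ-zv (avoid next (secondOnPath₁-valid m) (secondOnPath₁-apart m)) ⟩
      χ Y w ⊖ χ Y z                   ∎
    cancelling-hits : ∀ A B X → ((A ⊖ B) ⊕ X) ⊕ (0F ⊕ ((B ⊖ A) ⊕ (0F ⊕ 0F))) ≡ X
    cancelling-hits = solve-∀ ℤ₃-ring

  stars : MonochromaticStars C
  stars = stars-from-swap cycle alt (mid₁ 0) (leaf₁ 1) next {secondOnPath₁-unique m}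
                          z<s d1>1 (secondOnPath₁-valid m) swap-formula

penultimateOnPath₂ : ℕ → Label
penultimateOnPath₂ zero = p₂
penultimateOnPath₂ (suc _) = mid₂ 1

penultimateOnPath₂-valid : ∀ {d1 m1 d2 d3} m → Layout.Valid d1 m1 d2 (suc m) d3 (penultimateOnPath₂ m)
penultimateOnPath₂-valid zero = tt
penultimateOnPath₂-valid (suc _) = sz<ss

val-penultimateOnPath₂ : ∀ {d1 m1 d2 d3} m →
  pathPenultimate 1 (3 + m1) m ≡ Layout.val d1 m1 d2 (suc m) d3 (penultimateOnPath₂ m)
val-penultimateOnPath₂ zero = refl
val-penultimateOnPath₂ (suc _) = refl

penultimateOnPath₂-apart : ∀ m →
  False (penultimateOnPath₂ m ≟ₗ mid₂ 0) × False (penultimateOnPath₂ m ≟ₗ leaf₃ 1)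
penultimateOnPath₂-apart zero = _
penultimateOnPath₂-apart (suc _) = _

penultimateOnPath₂-unique : ∀ m →
  True (unique? (p₁ ∷ leaf₁ 0 ∷ p₃ ∷ leaf₃ 0 ∷ mid₂ 0 ∷ leaf₃ 1 ∷ penultimateOnPath₂ m ∷ []))
penultimateOnPath₂-unique zero = _
penultimateOnPath₂-unique (suc _) = _

module PathNeighbourOfP₃
  (d1 m1 d2 m d3 : ℕ) (χ : Coloring (C-order d1 m1 d2 (suc m) d3)) (χ-sym : Symmetric χ)
  (d1>0 : 0 < d1) (d3>1 : 1 < d3) {C : C4 (C-order d1 m1 d2 (suc m) d3)} (alt : Alternating χ C)
  where

  open Tree d1 m1 d2 (suc m) d3 χ χ-sym

  cycle : CycleEmbedding C
  cycle = cycle₁₃ C d1>0 (<⇒≤ d3>1)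

  previous : Label
  previous = penultimateOnPath₂ m

  swap-formula : ∀ {Y z w} h → Injective h →
    Realises h (placement cycle ((mid₂ 0 , z) ∷ (leaf₃ 1 , w) ∷ (previous , Y) ∷ [])) →
    swapDelta z w h edges ≡ χ Y w ⊖ χ Y z
  swap-formula h h-inj (_ ∷ _ ∷ _ ∷ _ ∷ refl ∷ refl ∷ refl ∷ []) = begin
    swapDelta z w h edges
      ≡⟨ swapDelta-pieces path₁-untouched through-z (star-untouched 0F) (star-untouched 1F)
           (trans (star-hit 2F d3>1 λ _ i≢1 → _ , leaf-other i≢1) (Δ-vw (avoid p₃ tt _))) ⟩
    0F ⊕ (((χ Y w ⊖ χ Y z) ⊕ ((χ P w ⊖ χ P z) ⊕ 0F)) ⊕ (0F ⊕ (0F ⊕ (χ P z ⊖ χ P w))))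
      ≡⟨ cancelling-hits (χ P w) (χ P z) (χ Y w ⊖ χ Y z) ⟩
    χ Y w ⊖ χ Y z ∎
    where
    open Swapping h h-inj {mid₂ 0} {leaf₃ 1} z<s d3>1
    s : ℕ
    s = 3 + m1
    P : Fin order
    P = h 2
    Y : Fin order
    Y = h (val previous)
    before-z : swapDelta z w h (pathEdges 1 (s + m) s m) ≡ χ Y w ⊖ χ Y z
    before-z = begin
      swapDelta z w h (pathEdges 1 (s + m) s m)
        ≡⟨ swapDelta-path-end h 1 (s + m) s m (avoid p₂ tt _) (avoid-path₂ (n≤1+n m) λ i i<m →
             fromWitnessFalse (mid₂-apart (<⇒≢ (m<n⇒0<n∸m i<m) ∘ sym)) , _) ⟩
      Δ z w (h (pathPenultimate 1 s m)) z
        ≡⟨ cong (λ k → Δ z w (h k) z) (val-penultimateOnPath₂ {d1} {m1} {d2} {d3} m) ⟩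
      Δ z w Y z
        ≡⟨ Δ-vz (avoid previous (penultimateOnPath₂-valid m) (penultimateOnPath₂-apart m)) ⟩
      χ Y w ⊖ χ Y z ∎
    through-z : swapDelta z w h path₂ ≡ (χ Y w ⊖ χ Y z) ⊕ ((χ P w ⊖ χ P z) ⊕ 0F)
    through-z = begin
      swapDelta z w h (pathEdges 1 2 s (suc m))
        ≡⟨ cong (swapDelta z w h) (pathEdges-snoc 1 2 s m) ⟩
      swapDelta z w h (pathEdges 1 (s + m) s m ++ (s + m , 2) ∷ [])
        ≡⟨ edgeSum-++ _ (pathEdges 1 (s + m) s m) _ ⟩
      swapDelta z w h (pathEdges 1 (s + m) s m) ⊕ (Δ z w z P ⊕ 0F)
        ≡⟨ cong₂ _⊕_ before-z (cong (_⊕ 0F) (Δ-zv (avoid p₃ tt _))) ⟩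
      (χ Y w ⊖ χ Y z) ⊕ ((χ P w ⊖ χ P z) ⊕ 0F) ∎
    cancelling-hits : ∀ A B X → 0F ⊕ ((X ⊕ ((A ⊖ B) ⊕ 0F)) ⊕ (0F ⊕ (0F ⊕ (B ⊖ A)))) ≡ X
    cancelling-hits = solve-∀ ℤ₃-ring

  stars : MonochromaticStars C
  stars = stars-from-swap cycle alt (mid₂ 0) (leaf₃ 1) previous {penultimateOnPath₂-unique m}
                          z<s d3>1 (penultimateOnPath₂-valid m) swap-formula

module SingleLeafAtP₁NextToP₂
  (m2 d2 d3 : ℕ) (χ : Coloring (C-order 1 0 d2 m2 d3)) (χ-sym : Symmetric χ)
  (d2>1 : 1 < d2) (d3>0 : 0 < d3) {C : C4 (C-order 1 0 d2 m2 d3)} (alt : Alternating χ C)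
  where

  open Tree 1 0 d2 m2 d3 χ χ-sym

  cycle : CycleEmbedding C
  cycle = cycle₂₃ C (<⇒≤ d2>1) d3>0

  swap-formula : ∀ {Y z w} h → Injective h →
    Realises h (placement cycle ((p₁ , z) ∷ (leaf₂ 1 , w) ∷ (leaf₁ 0 , Y) ∷ [])) →
    swapDelta z w h edges ≡ χ Y w ⊖ χ Y z
  swap-formula h h-inj (_ ∷ _ ∷ _ ∷ _ ∷ refl ∷ refl ∷ refl ∷ []) = begin
    swapDelta z w h edges
      ≡⟨ swapDelta-pieces (cong (_⊕ 0F) (Δ-zv (avoid p₂ tt _))) path₂-untouched
           (cong (_⊕ 0F) (Δ-zv (avoid (leaf₁ 0) z<s _)))
           (trans (star-hit 1F d2>1 λ _ i≢1 → _ , leaf-other i≢1) (Δ-vw (avoid p₂ tt _)))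
           (star-untouched 2F) ⟩
    ((χ P w ⊖ χ P z) ⊕ 0F) ⊕ (0F ⊕ (((χ Y w ⊖ χ Y z) ⊕ 0F) ⊕ ((χ P z ⊖ χ P w) ⊕ 0F)))
      ≡⟨ cancelling-hits (χ P w) (χ P z) (χ Y w ⊖ χ Y z) ⟩
    χ Y w ⊖ χ Y z ∎
    where
    open Swapping h h-inj {p₁} {leaf₂ 1} tt d2>1
    P : Fin order
    P = h 1
    Y : Fin order
    Y = h (val (leaf₁ 0))
    cancelling-hits : ∀ A B X → ((A ⊖ B) ⊕ 0F) ⊕ (0F ⊕ ((X ⊕ 0F) ⊕ ((B ⊖ A) ⊕ 0F))) ≡ X
    cancelling-hits = solve-∀ ℤ₃-ring

  stars : MonochromaticStars C
  stars = stars-from-swap cycle alt p₁ (leaf₂ 1) (leaf₁ 0) tt d2>1 z<s swap-formula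

module SingleLeafAtP₃NextToP₂
  (d1 m1 d2 : ℕ) (χ : Coloring (C-order d1 m1 d2 0 1)) (χ-sym : Symmetric χ)
  (d1>0 : 0 < d1) (d2>1 : 1 < d2) {C : C4 (C-order d1 m1 d2 0 1)} (alt : Alternating χ C)
  where

  open Tree d1 m1 d2 0 1 χ χ-sym

  cycle : CycleEmbedding C
  cycle = cycle₁₂ C d1>0 (<⇒≤ d2>1)

  swap-formula : ∀ {Y z w} h → Injective h →
    Realises h (placement cycle ((p₃ , z) ∷ (leaf₂ 1 , w) ∷ (leaf₃ 0 , Y) ∷ [])) →
    swapDelta z w h edges ≡ χ Y w ⊖ χ Y z
  swap-formula h h-inj (_ ∷ _ ∷ _ ∷ _ ∷ refl ∷ refl ∷ refl ∷ []) = begin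
    swapDelta z w h edges
      ≡⟨ swapDelta-pieces path₁-untouched (cong (_⊕ 0F) (Δ-vz (avoid p₂ tt _))) (star-untouched 0F)
           (trans (star-hit 1F d2>1 λ _ i≢1 → _ , leaf-other i≢1) (Δ-vw (avoid p₂ tt _)))
           (cong (_⊕ 0F) (Δ-zv (avoid (leaf₃ 0) z<s _))) ⟩
    0F ⊕ (((χ P w ⊖ χ P z) ⊕ 0F) ⊕ (0F ⊕ ((χ P z ⊖ χ P w) ⊕ ((χ Y w ⊖ χ Y z) ⊕ 0F))))
      ≡⟨ cancelling-hits (χ P w) (χ P z) (χ Y w ⊖ χ Y z) ⟩
    χ Y w ⊖ χ Y z ∎
    where
    open Swapping h h-inj {p₃} {leaf₂ 1} tt d2>1
    P : Fin order
    P = h 1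
    Y : Fin order
    Y = h (val (leaf₃ 0))
    cancelling-hits : ∀ A B X → 0F ⊕ (((A ⊖ B) ⊕ 0F) ⊕ (0F ⊕ ((B ⊖ A) ⊕ (X ⊕ 0F)))) ≡ X
    cancelling-hits = solve-∀ ℤ₃-ring

  stars : MonochromaticStars C
  stars = stars-from-swap cycle alt p₃ (leaf₂ 1) (leaf₃ 0) tt d2>1 z<s swap-formula

-- With c C at p₂, swapping z at p₃ with w at its first leaf changes the weight by χ u w ⊖ χ u z
-- for each other neighbour u of p₃. By same-as-c each of these d3 terms is κ = χ c w ⊖ χ c z,
-- and 3 ∤ d3 forces κ = 0.
module HubAtP₃
  (d1 m1 d2 d3 : ℕ) (χ : Coloring (C-order d1 m1 d2 0 d3)) (χ-sym : Symmetric χ)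
  (d1>0 : 0 < d1) (d2>0 : 0 < d2) (d3>1 : 1 < d3) (3∤d3 : ¬ 3 ∣ d3)
  {C : C4 (C-order d1 m1 d2 0 d3)} (alt : Alternating χ C)
  where

  open Tree d1 m1 d2 0 d3 χ χ-sym
  open RawMonad (Sumₗ.monad ZeroSumCopy 0ℓ) using (pure; _>>=_)

  d3>0 : 0 < d3
  d3>0 = <⇒≤ d3>1
  cycle : CycleEmbedding C
  cycle = cycle₁₂ C d1>0 d2>0

  same-as-c : SameDifferencesAs C (c C)
  same-as-c = transfer-to-c {C} alt d1>0 d3>0 d2>0 d3>1

  swap-formula : ∀ {z w} → OffCycle C z → OffCycle C w → ∀ h → Injective h →
    Realises h (placement cycle ((p₃ , z) ∷ (leaf₃ 0 , w) ∷ [])) →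
    ZeroSumCopy ⊎ (swapDelta z w h edges ≡ d3 · (χ (c C) w ⊖ χ (c C) z))
  swap-formula z-off w-off h h-inj realises@(_ ∷ _ ∷ ec ∷ _ ∷ refl ∷ refl ∷ []) = do
    hub ← centre-leaf-swap cycle same-as-c h-inj realises 2F d3>0 z-off w-off
    pure (begin
      swapDelta z w h edges
        ≡⟨ swapDelta-pieces path₁-untouched
             (cong (_⊕ 0F) (trans (Δ-vz (avoid p₂ tt _)) (cong (λ v → χ v w ⊖ χ v z) ec)))
             (star-untouched 0F) (star-untouched 1F) refl ⟩
      0F ⊕ ((κ ⊕ 0F) ⊕ (0F ⊕ (0F ⊕ starDelta 2F)))  ≡⟨ path₂-and-hub κ (starDelta 2F) ⟩
      κ ⊕ starDelta 2F                              ≡⟨ hub ⟩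
      d3 · κ                                        ∎)
    where
    open Swapping h h-inj {p₃} {leaf₃ 0} tt d3>0
    κ : ℤ₃
    κ = χ (c C) w ⊖ χ (c C) z
    path₂-and-hub : ∀ X S → 0F ⊕ ((X ⊕ 0F) ⊕ (0F ⊕ (0F ⊕ S))) ≡ X ⊕ S
    path₂-and-hub = solve-∀ ℤ₃-ring

  uniform : MonochromaticFrom C (c C)
  uniform {p} {q} p-off q-off p≢q = do
    d3·κ≡0 ← swap-vanishes cycle alt p₃ p (leaf₃ 0) q [] (tt ∷ d3>0 ∷ []) (p-off ∷ q-off ∷ [])
               ((p≢q ∷ []) ∷ [] ∷ []) (swap-formula p-off q-off)
    pure (x⊖y≡0⇒x≡y (χ (c C) q) (χ (c C) p) (·-cancel d3 (χ (c C) q ⊖ χ (c C) p) 3∤d3 d3·κ≡0))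

  stars : MonochromaticStars C
  stars = stars-from-transfer {C} (c C) same-as-c uniform

module HubAtP₁
  (d1 d2 m2 d3 : ℕ) (χ : Coloring (C-order d1 0 d2 m2 d3)) (χ-sym : Symmetric χ)
  (d1>1 : 1 < d1) (d2>0 : 0 < d2) (d3>0 : 0 < d3) (3∤d1 : ¬ 3 ∣ d1)
  {C : C4 (C-order d1 0 d2 m2 d3)} (alt : Alternating χ C)
  where

  open Tree d1 0 d2 m2 d3 χ χ-sym
  open RawMonad (Sumₗ.monad ZeroSumCopy 0ℓ) using (pure; _>>=_)

  d1>0 : 0 < d1
  d1>0 = <⇒≤ d1>1
  cycle : CycleEmbedding C
  cycle = cycle₂₃ C d2>0 d3>0

  same-as-a : SameDifferencesAs C (a C)
  same-as-a = transfer-to-a {C} alt d1>0 d3>0 d2>0 d1>1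

  swap-formula : ∀ {z w} → OffCycle C z → OffCycle C w → ∀ h → Injective h →
    Realises h (placement cycle ((p₁ , z) ∷ (leaf₁ 0 , w) ∷ [])) →
    ZeroSumCopy ⊎ (swapDelta z w h edges ≡ d1 · (χ (a C) w ⊖ χ (a C) z))
  swap-formula z-off w-off h h-inj realises@(ea ∷ _ ∷ _ ∷ _ ∷ refl ∷ refl ∷ []) = do
    hub ← centre-leaf-swap cycle same-as-a h-inj realises 0F d1>0 z-off w-off
    pure (begin
      swapDelta z w h edges
        ≡⟨ swapDelta-pieces
             (cong (_⊕ 0F) (trans (Δ-zv (avoid p₂ tt _)) (cong (λ v → χ v w ⊖ χ v z) ea)))
             path₂-untouched refl (star-untouched 1F) (star-untouched 2F) ⟩
      (κ ⊕ 0F) ⊕ (0F ⊕ (starDelta 0F ⊕ (0F ⊕ 0F)))  ≡⟨ path₁-and-hub κ (starDelta 0F) ⟩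
      κ ⊕ starDelta 0F                              ≡⟨ hub ⟩
      d1 · κ                                        ∎)
    where
    open Swapping h h-inj {p₁} {leaf₁ 0} tt d1>0
    κ : ℤ₃
    κ = χ (a C) w ⊖ χ (a C) z
    path₁-and-hub : ∀ X S → (X ⊕ 0F) ⊕ (0F ⊕ (S ⊕ (0F ⊕ 0F))) ≡ X ⊕ S
    path₁-and-hub = solve-∀ ℤ₃-ring

  uniform : MonochromaticFrom C (a C)
  uniform {p} {q} p-off q-off p≢q = do
    d1·κ≡0 ← swap-vanishes cycle alt p₁ p (leaf₁ 0) q [] (tt ∷ d1>0 ∷ []) (p-off ∷ q-off ∷ [])
               ((p≢q ∷ []) ∷ [] ∷ []) (swap-formula p-off q-off)
    pure (x⊖y≡0⇒x≡y (χ (a C) q) (χ (a C) p) (·-cancel d1 (χ (a C) q ⊖ χ (a C) p) 3∤d1 d1·κ≡0))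

  stars : MonochromaticStars C
  stars = stars-from-transfer {C} (a C) same-as-a uniform

-- The other neighbours of p₂ are its d2 − 1 further leaves, a C and c C; the term of a C is κ
-- by transfer-a-to-c, so κ is counted d2 + 1 times.
module HubAtP₂
  (d1 d2 d3 : ℕ) (χ : Coloring (C-order d1 0 d2 0 d3)) (χ-sym : Symmetric χ)
  (d1>1 : 1 < d1) (d2>0 : 0 < d2) (d3>1 : 1 < d3) (3∤1+d2 : ¬ 3 ∣ suc d2)
  {C : C4 (C-order d1 0 d2 0 d3)} (alt : Alternating χ C)
  where

  open Tree d1 0 d2 0 d3 χ χ-sym
  open RawMonad (Sumₗ.monad ZeroSumCopy 0ℓ) using (pure; _>>=_)

  d1>0 : 0 < d1
  d1>0 = <⇒≤ d1>1
  d3>0 : 0 < d3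
  d3>0 = <⇒≤ d3>1
  cycle : CycleEmbedding C
  cycle = cycle₁₃ C d1>0 d3>0

  same-as-c : SameDifferencesAs C (c C)
  same-as-c = transfer-to-c {C} alt d1>0 d3>0 d2>0 d3>1

  swap-formula : ∀ {z w} → OffCycle C z → OffCycle C w → z ≢ w → ∀ h → Injective h →
    Realises h (placement cycle ((p₂ , z) ∷ (leaf₂ 0 , w) ∷ [])) →
    ZeroSumCopy ⊎ (swapDelta z w h edges ≡ suc d2 · (χ (c C) w ⊖ χ (c C) z))
  swap-formula z-off w-off z≢w h h-inj realises@(ea ∷ _ ∷ ec ∷ _ ∷ refl ∷ refl ∷ []) = do
    hub ← centre-leaf-swap cycle same-as-c h-inj realises 1F d2>0 z-off w-off
    a-like-c ← transfer-a-to-c {C} alt d1>0 d3>0 d1>1 d3>1 z-off w-off z≢w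
    pure (begin
      swapDelta z w h edges
        ≡⟨ swapDelta-pieces
             (cong (_⊕ 0F) (trans (trans (Δ-vz (avoid p₁ tt _)) (cong (λ v → χ v w ⊖ χ v z) ea)) a-like-c))
             (cong (_⊕ 0F) (trans (Δ-zv (avoid p₃ tt _)) (cong (λ v → χ v w ⊖ χ v z) ec)))
             (star-untouched 0F) refl (star-untouched 2F) ⟩
      (κ ⊕ 0F) ⊕ ((κ ⊕ 0F) ⊕ (0F ⊕ (starDelta 1F ⊕ 0F)))  ≡⟨ paths-and-hub κ (starDelta 1F) ⟩
      κ ⊕ (κ ⊕ starDelta 1F)                              ≡⟨ cong (κ ⊕_) hub ⟩
      suc d2 · κ                                          ∎)
    where
    open Swapping h h-inj {p₂} {leaf₂ 0} tt d2>0
    κ : ℤ₃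
    κ = χ (c C) w ⊖ χ (c C) z
    paths-and-hub : ∀ X S → (X ⊕ 0F) ⊕ ((X ⊕ 0F) ⊕ (0F ⊕ (S ⊕ 0F))) ≡ X ⊕ (X ⊕ S)
    paths-and-hub = solve-∀ ℤ₃-ring

  uniform : MonochromaticFrom C (c C)
  uniform {p} {q} p-off q-off p≢q = do
    n·κ≡0 ← swap-vanishes cycle alt p₂ p (leaf₂ 0) q [] (tt ∷ d2>0 ∷ []) (p-off ∷ q-off ∷ [])
              ((p≢q ∷ []) ∷ [] ∷ []) (swap-formula p-off q-off p≢q)
    pure (x⊖y≡0⇒x≡y (χ (c C) q) (χ (c C) p)
            (·-cancel (suc d2) (χ (c C) q ⊖ χ (c C) p) 3∤1+d2 n·κ≡0))

  stars : MonochromaticStars C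
  stars = stars-from-transfer {C} (c C) same-as-c uniform

∣m+n∤n⇒∤m : ∀ {d m} n → d ∣ m + n → ¬ d ∣ n → ¬ d ∣ m
∣m+n∤n⇒∤m n d∣m+n d∤n d∣m = d∤n (∣m+n∣m⇒∣n d∣m+n d∣m)

private
  [1+1+n+2]≡n+4 : ∀ n → 1 + 1 + n + 0 + 0 + 2 ≡ n + 4
  [1+1+n+2]≡n+4 = ℕ-Solver.solve-∀

  [n+1+1+2]≡n+4 : ∀ n → n + 1 + 1 + 0 + 0 + 2 ≡ n + 4
  [n+1+1+2]≡n+4 = ℕ-Solver.solve-∀

  [l+m+n+2]≡[l+n+[1+m]]+1 : ∀ l m n → l + m + n + 0 + 0 + 2 ≡ (l + n + suc m) + 1
  [l+m+n+2]≡[l+n+[1+m]]+1 = ℕ-Solver.solve-∀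

monochromatic-stars-without-paths : ∀ d1 d2 d3 → 0 < d1 → 0 < d2 → 0 < d3 →
  3 ∣ d1 + d2 + d3 + 0 + 0 + 2 →
  ∀ (χ : Coloring (C-order d1 0 d2 0 d3)) (χ-sym : Symmetric χ) {C} → Alternating χ C →
  Tree.MonochromaticStars d1 0 d2 0 d3 χ χ-sym C
monochromatic-stars-without-paths 1 1 1 _ _ _ 3∣5 = ⊥-elim (from-no (3 ∣? 5) 3∣5)
monochromatic-stars-without-paths 1 1 d3@(suc (suc _)) d1>0 d2>0 _ 3∣ χ χ-sym {C} =
  HubAtP₃.stars 1 0 1 d3 χ χ-sym d1>0 d2>0 sz<ss 3∤d3 {C}
  where
  3∤d3 : ¬ 3 ∣ d3
  3∤d3 = ∣m+n∤n⇒∤m 4 (subst (3 ∣_) ([1+1+n+2]≡n+4 d3) 3∣) (from-no (3 ∣? 4))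
monochromatic-stars-without-paths 1 d2@(suc (suc _)) d3 _ _ d3>0 _ χ χ-sym {C} =
  SingleLeafAtP₁NextToP₂.stars 0 d2 d3 χ χ-sym sz<ss d3>0 {C}
monochromatic-stars-without-paths d1@(suc (suc _)) 1 1 _ d2>0 d3>0 3∣ χ χ-sym {C} =
  HubAtP₁.stars d1 1 0 1 χ χ-sym sz<ss d2>0 d3>0 3∤d1 {C}
  where
  3∤d1 : ¬ 3 ∣ d1
  3∤d1 = ∣m+n∤n⇒∤m 4 (subst (3 ∣_) ([n+1+1+2]≡n+4 d1) 3∣) (from-no (3 ∣? 4))
monochromatic-stars-without-paths d1@(suc (suc _)) d2@(suc (suc _)) 1 d1>0 _ _ _ χ χ-sym {C} =
  SingleLeafAtP₃NextToP₂.stars d1 0 d2 χ χ-sym d1>0 sz<ss {C}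
monochromatic-stars-without-paths d1@(suc (suc _)) d2 d3@(suc (suc _)) d1>0 d2>0 d3>0 3∣ χ χ-sym {C}
  with 3 ∣? d3 | 3 ∣? d1
... | no 3∤d3 | _ = HubAtP₃.stars d1 0 d2 d3 χ χ-sym d1>0 d2>0 sz<ss 3∤d3 {C}
... | yes _ | no 3∤d1 = HubAtP₁.stars d1 d2 0 d3 χ χ-sym sz<ss d2>0 d3>0 3∤d1 {C}
... | yes 3∣d3 | yes 3∣d1 = HubAtP₂.stars d1 d2 d3 χ χ-sym sz<ss d2>0 sz<ss 3∤1+d2 {C}
  where
  3∤1+d2 : ¬ 3 ∣ suc d2
  3∤1+d2 3∣1+d2 = from-no (3 ∣? 1)
    (∣m+n∣m⇒∣n (subst (3 ∣_) ([l+m+n+2]≡[l+n+[1+m]]+1 d1 d2 d3) 3∣)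
               (∣m∣n⇒∣m+n (∣m∣n⇒∣m+n 3∣d1 3∣d3) 3∣1+d2))

monochromatic-stars : ∀ d1 m1 d2 m2 d3 → 0 < d1 → 0 < d2 → 0 < d3 → 3 ∣ d1 + d2 + d3 + m1 + m2 + 2 →
  ∀ (χ : Coloring (C-order d1 m1 d2 m2 d3)) (χ-sym : Symmetric χ) {C} → Alternating χ C →
  Tree.MonochromaticStars d1 m1 d2 m2 d3 χ χ-sym C
monochromatic-stars 1 (suc m) d2 m2 d3 _ d2>0 d3>0 _ χ χ-sym {C} =
  SingleLeafAtP₁.stars m d2 m2 d3 χ χ-sym d2>0 d3>0 {C}
monochromatic-stars d1@(suc (suc _)) (suc m) d2 m2 d3 _ _ d3>0 _ χ χ-sym {C} =
  PathNeighbourOfP₁.stars m d1 d2 m2 d3 χ χ-sym sz<ss d3>0 {C}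
monochromatic-stars d1 0 d2 (suc m) 1 d1>0 d2>0 _ _ χ χ-sym {C} =
  SingleLeafAtP₃.stars d1 0 d2 m χ χ-sym d1>0 d2>0 {C}
monochromatic-stars d1 0 d2 (suc m) d3@(suc (suc _)) d1>0 _ _ _ χ χ-sym {C} =
  PathNeighbourOfP₃.stars d1 0 d2 m d3 χ χ-sym d1>0 sz<ss {C}
monochromatic-stars d1 0 d2 0 d3 = monochromatic-stars-without-paths d1 d2 d3

proposition4p20 :
    (d1 d2 d3 m1 m2 : ℕ) →
    1 ≤ d1 → 1 ≤ d2 → 1 ≤ d3 → m1 ≤ 2 → m2 ≤ 2 →
    3 ∣ (d1 + d2 + d3 + m1 + m2 + 2) →
    (χ : Coloring (C-order d1 m1 d2 m2 d3)) → Symmetric χ →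
    AlphaC4≥1 χ →
    Σ (C4 (C-order d1 m1 d2 m2 d3)) (λ C → Alternating χ C × NotMonoOff χ C) →
    HasZeroSumCopy d1 m1 d2 m2 d3 χ
proposition4p20 d1 d2 d3 m1 m2 d1≥1 d2≥1 d3≥1 _ _ 3∣ χ χ-sym _ (C , alt , not-mono) =
  Tree.monochromatic-stars⇒zero-sum d1 m1 d2 m2 d3 χ χ-sym {C}
    (monochromatic-stars d1 m1 d2 m2 d3 d1≥1 d2≥1 d3≥1 3∣ χ χ-sym {C} alt) not-mono
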